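{- Let $\Gamma=\mathbb{Z}^2\rtimes\mathcal{C}_s$ (the maps $x\mapsto\sigma x+(c,d)$, $c,d\in\mathbb{Z}$, $\sigma\in\{\mathrm{id},s\}$, $s(x,y)=(x,-y)$). Let $(G,m)$ be a $\Gamma$-gain graph that derives a well-positioned $\Gamma$-symmetric framework $(\tilde G,\tilde p)$ in $(\mathbb{R}^2,\|\cdot\|_\infty)$. Then $(\tilde G,\tilde p)$ is minimally $\Gamma$-symmetrically infinitesimally rigid if and only if both: (1) the monochrome subgraph $G_1$ is a spanning tree of $G$; and (2) the monochrome subgraph $G_2$ is a spanning map graph of $G$ in which no connected component is purely periodic.
   Context: $\|(a_1,a_2)\|_\infty=\max\{|a_1|,|a_2|\}$. $\kappa(x,y)=(1,0)$ if $|x|>|y|$, $(0,1)$ if $|x|<|y|$, $(0,0)$ if $|x|=|y|$. An infinitesimal motion in $(\mathbb{R}^2,\|\cdot\|_\infty)$ of $(\tilde G,\tilde p)$ is $u:\tilde V\to\mathbb{R}^2$ with $\kappa(\tilde p(x)-\tilde p(y))\cdot(u(x)-u(y))=0$ for all edges; trivial motions are constant maps. A $\Gamma$-gain graph is a finite multigraph $G=(V,E)$ (loops, parallel edges allowed), edges oriented with gains in $\Gamma$, parallel edges of equal orientation with distinct gains, loops with non-identity gains; $(v_i,v_j;g)$ denotes an edge. Net gain of a walk: product of gains along it (inverse for backward edges); gain space of a subgraph $H$ at $v$: subgroup generated by net gains of closed walks in $H$ at $v$; $H$ is purely periodic if all gain spaces consist only of translations. Derived graph: vertices $\gamma v$,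 edges $\{\gamma v_i,\gamma gv_j\}$ for each edge $(v_i,v_j;g)$ and $\gamma\in\Gamma$ (an edge orbit); $p$ derives $\tilde p(\gamma v)=\gamma p(v)$ (distinct endpoints on edges required). $\Gamma$-symmetric infinitesimal motion: $u(\gamma x)=\gamma_lu(x)$ ($\gamma_l=\sigma$). Minimally $\Gamma$-symmetrically infinitesimally rigid: every $\Gamma$-symmetric infinitesimal motion is constant, and removing any edge orbit destroys this. Well-positioned: $\kappa(\tilde p(x)-\tilde p(y))\neq(0,0)$ for every edge of $\tilde G$. An edge of $G$ has framework colour 1 if its derived edges have $\kappa=(1,0)$ and colour 2 if $\kappa=(0,1)$ (constant over each edge orbit); $G_1,G_2$ are the spanning subgraphs of $G$ of colour-1, resp. colour-2, edges. A map graph is a multigraph each of whose connected components contains exactly one cycle (a loop counts as a cycle). -}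

module Defs where

open import Level using (0ℓ)
open import Data.Nat as ℕ using (ℕ; zero; suc)
open import Data.Integer as ℤ using (ℤ; +_; -[1+_])
open import Data.Bool using (Bool; true; false; _xor_)
open import Data.Fin using (Fin)
open import Data.List using (List; []; _∷_)
open import Data.List.Membership.Propositional using (_∈_)
open import Data.List.Relation.Unary.Unique.Propositional using (Unique)
open import Data.Product using (Σ; ∃; ∃-syntax; _×_; _,_; proj₁; proj₂)
open import Relation.Binary.PropositionalEquality using (_≡_)
open import Relation.Binary.Structures using (IsStrictTotalOrder)
open import Relation.Binary.Definitions using (tri<; tri≈; tri>)
open import Relation.Nullary using (¬_)
open import Algebra.Structures using (IsCommutativeRing)
open import Function.Bundles using (_⇔_)
open import Data.Sum using (_⊎_)
open import Data.Unit using (⊤)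

-- The real numbers, axiomatised as a (Dedekind-)complete ordered field.
-- (agda-stdlib has no ℝ; every model of this record is isomorphic to ℝ.)

record RealNumbers : Set₁ where
  infixl 6 _+_
  infixl 7 _*_
  infix 4 _<_
  field
    ℝ : Set
    0ℝ 1ℝ : ℝ
    _+_ _*_ : ℝ → ℝ → ℝ
    -_ : ℝ → ℝ
    _<_ : ℝ → ℝ → Set
    isCommutativeRing : IsCommutativeRing _≡_ _+_ _*_ -_ 0ℝ 1ℝ
    0≢1 : ¬ (0ℝ ≡ 1ℝ)
    inverse : ∀ x → ¬ (x ≡ 0ℝ) → Σ ℝ (λ y → x * y ≡ 1ℝ)
    isStrictTotalOrder : IsStrictTotalOrder _≡_ _<_
    +-mono-< : ∀ {x y} z → x < y → x + z < y + z
    *-pos : ∀ {x y} → 0ℝ < x → 0ℝ < y → 0ℝ < x * y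
    -- least upper bound property (x ≤ y written as x < y ⊎ x ≡ y)
    complete : (P : ℝ → Set) → ∃ P → (∃[ b ] (∀ x → P x → (x < b) ⊎ (x ≡ b))) →
               ∃[ s ] ((∀ x → P x → (x < s) ⊎ (x ≡ s)) ×
                       (∀ b → (∀ x → P x → (x < b) ⊎ (x ≡ b)) → (s < b) ⊎ (s ≡ b)))

-- The group Γ = ℤ² ⋊ C_s.  An element (c , d , σ) is the map
-- x ↦ σ x + (c , d), where σ = false is id and σ = true is s(x,y)=(x,-y).

record Γ : Set where
  constructor ⟨_,_,_⟩
  field
    tx ty : ℤ
    refl? : Bool
open Γ public

idΓ : Γ
idΓ = ⟨ + 0 , + 0 , false ⟩

linℤ : Bool → ℤ × ℤ → ℤ × ℤ
linℤ false (c , d) = (c , d)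
linℤ true  (c , d) = (c , ℤ.- d)

-- composition: (γ₁ ∙ γ₂) x = γ₁ (γ₂ x)
_∙_ : Γ → Γ → Γ
⟨ c₁ , d₁ , σ₁ ⟩ ∙ ⟨ c₂ , d₂ , σ₂ ⟩ =
  let (c , d) = linℤ σ₁ (c₂ , d₂) in ⟨ c ℤ.+ c₁ , d ℤ.+ d₁ , σ₁ xor σ₂ ⟩

_⁻¹ : Γ → Γ
⟨ c , d , σ ⟩ ⁻¹ = let (c' , d') = linℤ σ (c , d) in ⟨ ℤ.- c' , ℤ.- d' , σ ⟩

IsTranslation : Γ → Set
IsTranslation γ = refl? γ ≡ false

record GainGraph (n m : ℕ) : Set where
  field
    src tgt : Fin m → Fin n
    gain : Fin m → Γ
    parallel-distinct : ∀ e f → ¬ (e ≡ f) → src e ≡ src f → tgt e ≡ tgt f →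
                        ¬ (gain e ≡ gain f)
    loop-nontrivial : ∀ e → src e ≡ tgt e → ¬ (gain e ≡ idΓ)
open GainGraph public

module _ {n m : ℕ} (G : GainGraph n m) where

  data Walk (S : Fin m → Set) : Fin n → Fin n → Set where
    []  : ∀ {v} → Walk S v v
    fwd : ∀ {w} (e : Fin m) → S e → Walk S (tgt G e) w → Walk S (src G e) w
    bwd : ∀ {w} (e : Fin m) → S e → Walk S (src G e) w → Walk S (tgt G e) w

  module _ {S : Fin m → Set} where
    walkEdges : ∀ {a b} → Walk S a b → List (Fin m)
    walkEdges [] = []
    walkEdges (fwd e _ w) = e ∷ walkEdges w
    walkEdges (bwd e _ w) = e ∷ walkEdges w

    -- vertices visited after the start vertex (ends with the end vertex)
    walkVertices : ∀ {a b} → Walk S a b → List (Fin n)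
    walkVertices [] = []
    walkVertices (fwd e _ w) = tgt G e ∷ walkVertices w
    walkVertices (bwd e _ w) = src G e ∷ walkVertices w

    netGain : ∀ {a b} → Walk S a b → Γ
    netGain [] = idΓ
    netGain (fwd e _ w) = gain G e ∙ netGain w
    netGain (bwd e _ w) = (gain G e ⁻¹) ∙ netGain w

    length : ∀ {a b} → Walk S a b → ℕ
    length [] = 0
    length (fwd _ _ w) = suc (length w)
    length (bwd _ _ w) = suc (length w)

  -- a cycle: a nonempty closed walk with no repeated edges and no repeated
  -- vertices (a loop, and a pair of parallel edges, are cycles)
  record Cycle (S : Fin m → Set) : Set where
    field
      base : Fin n
      walk : Walk S base base
      nonempty : 0 ℕ.< length walk
      edges-distinct : Unique (walkEdges walk)
      vertices-distinct : Unique (walkVertices walk)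

  SameEdgeSet : ∀ {S} → Cycle S → Cycle S → Set
  SameEdgeSet C D = ∀ e → (e ∈ walkEdges (Cycle.walk C)) ⇔ (e ∈ walkEdges (Cycle.walk D))

  InComponent : ∀ {S} → Fin n → Cycle S → Set
  InComponent {S} v C = Walk S v (Cycle.base C)

  Connected : (Fin m → Set) → Set
  Connected S = ∀ a b → Walk S a b

  IsSpanningTree : (Fin m → Set) → Set
  IsSpanningTree S = Connected S × ¬ Cycle S

  -- (V , S) is a spanning map graph of G: each connected component
  -- contains exactly one cycle
  IsSpanningMapGraph : (Fin m → Set) → Set
  IsSpanningMapGraph S = ∀ v → Σ (Cycle S) λ C → InComponent v C ×
    (∀ D → InComponent v D → SameEdgeSet C D)

  data _∈GainSpace_at_ : Γ → (Fin m → Set) → Fin n → Set₁ where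
    gen : ∀ {S w} (c : Walk S w w) → netGain c ∈GainSpace S at w
    unit : ∀ {S w} → idΓ ∈GainSpace S at w
    mul : ∀ {S w g h} → g ∈GainSpace S at w → h ∈GainSpace S at w →
          (g ∙ h) ∈GainSpace S at w
    inv : ∀ {S w g} → g ∈GainSpace S at w → (g ⁻¹) ∈GainSpace S at w

  -- the connected component of (V,S) containing v is purely periodic:
  -- (its closed walks are those of (V,S) at its vertices)
  ComponentPurelyPeriodic : (Fin m → Set) → Fin n → Set₁
  ComponentPurelyPeriodic S v =
    ∀ w → Walk S v w → ∀ g → g ∈GainSpace S at w → IsTranslation g

module Geometry (R : RealNumbers) where
  open RealNumbers R
  open IsStrictTotalOrder isStrictTotalOrder using (compare)

  ℝ² : Set
  ℝ² = ℝ × ℝ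

  _+²_ _-²_ : ℝ² → ℝ² → ℝ²
  (a , b) +² (c , d) = (a + c , b + d)
  (a , b) -² (c , d) = (a + (- c) , b + (- d))

  _·_ : ℝ² → ℝ² → ℝ
  (a , b) · (c , d) = a * c + b * d

  ∣_∣ : ℝ → ℝ
  ∣ x ∣ with compare x 0ℝ
  ... | tri< _ _ _ = - x
  ... | tri≈ _ _ _ = x
  ... | tri> _ _ _ = x

  κ : ℝ² → ℝ²
  κ (x , y) with compare ∣ x ∣ ∣ y ∣
  ... | tri< _ _ _ = (0ℝ , 1ℝ)
  ... | tri≈ _ _ _ = (0ℝ , 0ℝ)
  ... | tri> _ _ _ = (1ℝ , 0ℝ)

  ιℕ : ℕ → ℝ
  ιℕ zero = 0ℝ
  ιℕ (suc k) = 1ℝ + ιℕ k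

  ιℤ : ℤ → ℝ
  ιℤ (+ k) = ιℕ k
  ιℤ -[1+ k ] = - ιℕ (suc k)

  lin : Γ → ℝ² → ℝ²
  lin γ (x , y) with refl? γ
  ... | false = (x , y)
  ... | true  = (x , - y)

  act : Γ → ℝ² → ℝ²
  act γ v = lin γ v +² (ιℤ (tx γ) , ιℤ (ty γ))

  module _ {n m : ℕ} (G : GainGraph n m) (p : Fin n → ℝ²) where

    -- derived graph: vertices γv ≅ Γ × Fin n; edge orbit of e consists of
    -- {γ src e , γ (gain e) tgt e} for γ ∈ Γ
    p̃ : Γ × Fin n → ℝ²
    p̃ (γ , v) = act γ (p v)

    dirOf : Fin m → Γ → ℝ²
    dirOf e γ = p̃ (γ , src G e) -² p̃ (γ ∙ gain G e , tgt G e)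

    Derives : Set
    Derives = ∀ e γ → ¬ (p̃ (γ , src G e) ≡ p̃ (γ ∙ gain G e , tgt G e))

    WellPositioned : Set
    WellPositioned = ∀ e γ → ¬ (κ (dirOf e γ) ≡ (0ℝ , 0ℝ))

    IsInfMotion : (Fin m → Set) → (Γ × Fin n → ℝ²) → Set
    IsInfMotion S u = ∀ e → S e → ∀ γ →
      κ (dirOf e γ) · (u (γ , src G e) -² u (γ ∙ gain G e , tgt G e)) ≡ 0ℝ

    IsΓSymmetric : (Γ × Fin n → ℝ²) → Set
    IsΓSymmetric u = ∀ γ δ v → u (γ ∙ δ , v) ≡ lin γ (u (δ , v))

    IsTrivial : (Γ × Fin n → ℝ²) → Set
    IsTrivial u = ∀ x y → u x ≡ u y

    SymInfRigid : (Fin m → Set) → Set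
    SymInfRigid S = ∀ u → IsΓSymmetric u → IsInfMotion S u → IsTrivial u

    AllEdges : Fin m → Set
    AllEdges _ = ⊤

    MinSymInfRigid : Set
    MinSymInfRigid = SymInfRigid AllEdges ×
                     (∀ e → ¬ SymInfRigid (λ f → ¬ (f ≡ e)))

    Colour₁ Colour₂ : Fin m → Set
    Colour₁ e = ∀ γ → κ (dirOf e γ) ≡ (1ℝ , 0ℝ)
    Colour₂ e = ∀ γ → κ (dirOf e γ) ≡ (0ℝ , 1ℝ)

-- A Γ-symmetric motion u is determined by U v = u (id , v), and the constraint of an edge orbit
-- involves U alone: κ is constant on the orbit, a colour-1 edge (v, w; g) asks that the
-- x-coordinates of U agree at v and w, and a colour-2 edge asks y(v) = ± y(w), with a minus
-- sign iff g contains the reflection. So the x- and y-coordinates are independent potentials.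
-- All x-potentials are constant iff G₁ is connected; all y-potentials vanish iff every
-- component of G₂ has a closed walk with an odd number of reflections, which is exactly the
-- failure of pure periodicity. Minimality splits by colour: a colour-1 edge is redundant iff
-- it lies on a cycle of G₁, and a colour-2 edge is redundant iff it lies on a balanced cycle
-- or G₂ minus the edge still has unbalanced cycles on both of its sides.

module Submission where

open import Defs
open import Level using (0ℓ)
open import Function using (_∘_; case_of_)
open import Function.Bundles using (_⇔_; mk⇔; Equivalence)
import Function.Properties.Equivalence as ⇔
open import Data.Nat as ℕ using (ℕ; zero; suc; z≤n; s≤s)
import Data.Nat.Properties as ℕ
open import Data.Integer as ℤ using (ℤ; -[1+_])
import Data.Integer.Properties as ℤ
open import Data.Fin as Fin using (Fin)
import Data.Fin.Properties as Fin
open import Data.Bool using (Bool; true; false; not; _xor_)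
import Data.Bool.Properties as Bool
open import Data.Unit using (tt)
open import Data.Empty using (⊥; ⊥-elim)
open import Data.Product using (Σ; ∃; _×_; _,_; proj₁; proj₂)
open import Data.Product.Function.NonDependent.Propositional using (_×-⇔_)
open import Data.Sum using (_⊎_; inj₁; inj₂)
open import Data.List as List using (List; []; _∷_; _++_)
open import Data.List.Membership.Propositional using (_∈_; _∉_)
open import Data.List.Membership.Propositional.Properties using (∈-lookup; ∈-++⁻; ∈-++⁺ˡ; ∈-++⁺ʳ)
open import Data.List.Relation.Unary.Any using (here; there)
import Data.List.Relation.Unary.All as All
open import Data.List.Relation.Unary.All.Properties using (¬Any⇒All¬; All¬⇒¬Any)
open import Data.List.Relation.Unary.AllPairs using ([]; _∷_)
open import Data.List.Relation.Unary.Unique.Propositional using (Unique)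
open import Relation.Nullary using (¬_; Dec; yes; no; does)
open import Relation.Nullary.Decidable using (map′; _×-dec_; _⊎-dec_; ¬?; decidable-stable; dec-true; dec-false)
open import Relation.Unary using (Pred; _⊆_; _∩_; _∖_; ｛_｝; Decidable)
open import Relation.Binary.PropositionalEquality
open import Relation.Binary.Definitions using (tri<; tri≈; tri>)
open import Relation.Binary.Structures using (IsStrictTotalOrder)
open import Algebra.Bundles using (CommutativeRing)

xor-leftComm : ∀ x a b → x xor (a xor b) ≡ a xor (x xor b)
xor-leftComm false a b = refl
xor-leftComm true  a b = Bool.not-distribʳ-xor a b

xor-cancel-middle : ∀ x a b → x xor (a xor (x xor b)) ≡ a xor b
xor-cancel-middle false a b = refl
xor-cancel-middle true  a b = trans (Bool.not-distribʳ-xor a (not b)) (cong (a xor_) (Bool.not-involutive b))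

xor-cancelˡ : ∀ x {a b} → x xor a ≡ x xor b → a ≡ b
xor-cancelˡ x {a} {b} eq = trans (sym (xor-cancel-middle x false a)) (trans (cong (x xor_) eq) (xor-cancel-middle x false b))

≢⇒xor≡true : ∀ {a b} → ¬ a ≡ b → a xor b ≡ true
≢⇒xor≡true {false} {false} a≢b = ⊥-elim (a≢b refl)
≢⇒xor≡true {false} {true}  _   = refl
≢⇒xor≡true {true}  {false} _   = refl
≢⇒xor≡true {true}  {true}  a≢b = ⊥-elim (a≢b refl)

unique⇒length≤ : ∀ {k} {xs : List (Fin k)} → Unique xs → List.length xs ℕ.≤ k
unique⇒length≤ {k} {xs} u with List.length xs ℕ.≤? k
... | yes ≤k = ≤k
... | no  ≰k with Fin.pigeonhole (ℕ.≰⇒> ≰k) (List.lookup xs)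
...   | i , j , i<j , eq = ⊥-elim (lookup-distinct u i j i<j eq)
  where
  lookup-distinct : ∀ {ys : List (Fin k)} → Unique ys → ∀ i j → i Fin.< j → ¬ List.lookup ys i ≡ List.lookup ys j
  lookup-distinct (y∉ ∷ _) Fin.zero    (Fin.suc j) _         = All.lookup y∉ (∈-lookup j)
  lookup-distinct (_  ∷ u) (Fin.suc i) (Fin.suc j) (s≤s i<j) = lookup-distinct u i j i<j

unique-middle : ∀ {A : Set} (xs : List A) {x ys} → Unique (xs ++ x ∷ ys) → x ∉ xs ++ ys
unique-middle []       (x∉ys ∷ _) = All¬⇒¬Any x∉ys
unique-middle (z ∷ xs) (z∉ ∷ u) (here refl) = All.lookup z∉ (∈-++⁺ʳ xs (here refl)) refl
unique-middle (z ∷ xs) (z∉ ∷ u) (there i)   = unique-middle xs u i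

unique-rotate : ∀ {A : Set} (xs : List A) {x ys} → Unique (xs ++ x ∷ ys) → x ∉ ys ++ xs
unique-rotate xs {ys = ys} u x∈ with ∈-++⁻ ys x∈
... | inj₁ x∈ys = unique-middle xs u (∈-++⁺ʳ xs x∈ys)
... | inj₂ x∈xs = unique-middle xs u (∈-++⁺ˡ x∈xs)

∙-identityʳ : ∀ γ → γ ∙ idΓ ≡ γ
∙-identityʳ ⟨ c , d , false ⟩ = cong₂ (λ a b → ⟨ a , b , false ⟩) (ℤ.+-identityˡ c) (ℤ.+-identityˡ d)
∙-identityʳ ⟨ c , d , true  ⟩ = cong₂ (λ a b → ⟨ a , b , true ⟩) (ℤ.+-identityˡ c) (ℤ.+-identityˡ d)

module OrderedFieldFacts (R : RealNumbers) where
  open RealNumbers R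
  open IsStrictTotalOrder isStrictTotalOrder public using (_≟_; compare)
  open IsStrictTotalOrder isStrictTotalOrder using (asym; irrefl)

  commutativeRing : CommutativeRing 0ℓ 0ℓ
  commutativeRing = record { isCommutativeRing = isCommutativeRing }

  open CommutativeRing commutativeRing public
    using (+-assoc; +-comm; +-identityˡ; +-identityʳ; -‿inverseʳ; *-identityˡ; zeroˡ; +-abelianGroup)
  open import Algebra.Properties.AbelianGroup +-abelianGroup public using ()
    renaming ( ε⁻¹≈ε to -0≡0; ⁻¹-involutive to -‿involutive; ⁻¹-∙-comm to -‿+-comm
             ; x∙y⁻¹≈ε⇒x≈y to x-y≡0⇒x≡y; x≈y⇒x∙y⁻¹≈ε to x≡y⇒x-y≡0)
  open import Algebra.Properties.AbelianGroup +-abelianGroup using (xyx⁻¹≈y)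

  [x+t]-[y+t]≡x-y : ∀ x y t → (x + t) + - (y + t) ≡ x + - y
  [x+t]-[y+t]≡x-y x y t = begin
    (x + t) + - (y + t)    ≡⟨ cong ((x + t) +_) (sym (-‿+-comm y t)) ⟩
    (x + t) + (- y + - t)  ≡⟨ +-assoc x t _ ⟩
    x + (t + (- y + - t))  ≡⟨ cong (x +_) (sym (+-assoc t (- y) (- t))) ⟩
    x + (t + - y + - t)    ≡⟨ cong (x +_) (xyx⁻¹≈y t (- y)) ⟩
    x + - y                ∎
    where open ≡-Reasoning

  neg<0⇒pos : ∀ {y} → y < 0ℝ → 0ℝ < - y
  neg<0⇒pos {y} y<0 = subst₂ _<_ (-‿inverseʳ y) (+-identityˡ (- y)) (+-mono-< (- y) y<0)

  pos⇒neg<0 : ∀ {y} → 0ℝ < y → - y < 0ℝ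
  pos⇒neg<0 {y} 0<y = subst₂ _<_ (+-identityˡ (- y)) (-‿inverseʳ y) (+-mono-< (- y) 0<y)

  x≡-x⇒x≡0 : ∀ {x} → x ≡ - x → x ≡ 0ℝ
  x≡-x⇒x≡0 {x} x≡-x with compare x 0ℝ
  ... | tri< x<0 _ _ = ⊥-elim (asym x<0 (subst (0ℝ <_) (sym x≡-x) (neg<0⇒pos x<0)))
  ... | tri≈ _ x≡0 _ = x≡0
  ... | tri> _ _ 0<x = ⊥-elim (asym 0<x (subst (_< 0ℝ) (sym x≡-x) (pos⇒neg<0 0<x)))

  negateIf : Bool → ℝ → ℝ
  negateIf false y = y
  negateIf true  y = - y

  negateIf-xor : ∀ a b y → negateIf (a xor b) y ≡ negateIf a (negateIf b y)
  negateIf-xor false b     y = refl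
  negateIf-xor true  false y = refl
  negateIf-xor true  true  y = sym (-‿involutive y)

  negateIf-involutive : ∀ a y → negateIf a (negateIf a y) ≡ y
  negateIf-involutive false y = refl
  negateIf-involutive true  y = -‿involutive y

  negateIf-0 : ∀ a → negateIf a 0ℝ ≡ 0ℝ
  negateIf-0 false = refl
  negateIf-0 true  = -0≡0

  negateIf-≡0 : ∀ a {y} → negateIf a y ≡ 0ℝ → y ≡ 0ℝ
  negateIf-≡0 a {y} eq = trans (sym (negateIf-involutive a y)) (trans (cong (negateIf a) eq) (negateIf-0 a))

  x≡0⇒-x≡x : ∀ {x} → x ≡ 0ℝ → - x ≡ x
  x≡0⇒-x≡x refl = -0≡0

  ∣-x∣≡∣x∣ : ∀ x → Geometry.∣_∣ R (- x) ≡ Geometry.∣_∣ R x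
  ∣-x∣≡∣x∣ x with compare x 0ℝ | compare (- x) 0ℝ
  ... | tri< x<0 _ _ | tri< -x<0 _ _  = ⊥-elim (asym -x<0 (neg<0⇒pos x<0))
  ... | tri< x<0 _ _ | tri≈ _ -x≡0 _  = ⊥-elim (irrefl (sym -x≡0) (neg<0⇒pos x<0))
  ... | tri< _ _ _   | tri> _ _ _     = refl
  ... | tri≈ _ x≡0 _ | tri< -x<0 _ _  = ⊥-elim (irrefl (x≡0⇒-x≡x x≡0) (subst (- x <_) (sym x≡0) -x<0))
  ... | tri≈ _ x≡0 _ | tri≈ _ _ _     = x≡0⇒-x≡x x≡0
  ... | tri≈ _ x≡0 _ | tri> _ _ 0<-x  = ⊥-elim (irrefl (sym (x≡0⇒-x≡x x≡0)) (subst (_< - x) (sym x≡0) 0<-x))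
  ... | tri> _ _ _   | tri< _ _ _     = -‿involutive x
  ... | tri> _ _ 0<x | tri≈ _ -x≡0 _  = ⊥-elim (irrefl -x≡0 (pos⇒neg<0 0<x))
  ... | tri> _ _ 0<x | tri> _ _ 0<-x  = ⊥-elim (asym 0<-x (pos⇒neg<0 0<x))

module PlaneActionFacts (R : RealNumbers) where
  open RealNumbers R
  open OrderedFieldFacts R
  open Geometry R
  open IsStrictTotalOrder isStrictTotalOrder using (asym; irrefl)

  ιℕ-+ : ∀ m n → ιℕ (m ℕ.+ n) ≡ ιℕ m + ιℕ n
  ιℕ-+ zero    n = sym (+-identityˡ (ιℕ n))
  ιℕ-+ (suc m) n = trans (cong (1ℝ +_) (ιℕ-+ m n)) (sym (+-assoc 1ℝ (ιℕ m) (ιℕ n)))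

  ιℤ-⊖ : ∀ m n → ιℤ (m ℤ.⊖ n) ≡ ιℕ m + - ιℕ n
  ιℤ-⊖ zero    zero    = sym (-‿inverseʳ 0ℝ)
  ιℤ-⊖ zero    (suc n) = sym (+-identityˡ _)
  ιℤ-⊖ (suc m) zero    = sym (trans (cong (ιℕ (suc m) +_) -0≡0) (+-identityʳ _))
  ιℤ-⊖ (suc m) (suc n) = begin
    ιℤ (suc m ℤ.⊖ suc n)             ≡⟨ cong ιℤ (ℤ.[1+m]⊖[1+n]≡m⊖n m n) ⟩
    ιℤ (m ℤ.⊖ n)                     ≡⟨ ιℤ-⊖ m n ⟩
    ιℕ m + - ιℕ n                    ≡⟨ [x+t]-[y+t]≡x-y (ιℕ m) (ιℕ n) 1ℝ ⟨
    (ιℕ m + 1ℝ) + - (ιℕ n + 1ℝ)      ≡⟨ cong₂ (λ a b → a + - b) (+-comm (ιℕ m) 1ℝ) (+-comm (ιℕ n) 1ℝ) ⟩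
    ιℕ (suc m) + - ιℕ (suc n)        ∎
    where open ≡-Reasoning

  ιℤ-neg : ∀ i → ιℤ (ℤ.- i) ≡ - ιℤ i
  ιℤ-neg (ℤ.+ zero)  = sym -0≡0
  ιℤ-neg (ℤ.+ suc n) = refl
  ιℤ-neg -[1+ n ]    = sym (-‿involutive _)

  ιℤ-+ : ∀ i j → ιℤ (i ℤ.+ j) ≡ ιℤ i + ιℤ j
  ιℤ-+ -[1+ m ]   -[1+ n ]   = begin
    - ιℕ (suc (suc (m ℕ.+ n)))         ≡⟨ cong (λ k → - ιℕ (suc k)) (ℕ.+-suc m n) ⟨
    - ιℕ (suc m ℕ.+ suc n)             ≡⟨ cong -_ (ιℕ-+ (suc m) (suc n)) ⟩
    - (ιℕ (suc m) + ιℕ (suc n))        ≡⟨ -‿+-comm _ _ ⟨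
    - ιℕ (suc m) + - ιℕ (suc n)        ∎
    where open ≡-Reasoning
  ιℤ-+ -[1+ m ]   (ℤ.+ n)    = trans (ιℤ-⊖ n (suc m)) (+-comm _ _)
  ιℤ-+ (ℤ.+ m)    -[1+ n ]   = ιℤ-⊖ m (suc n)
  ιℤ-+ (ℤ.+ m)    (ℤ.+ n)    = ιℕ-+ m n

  lin≡negateIf : ∀ γ v → lin γ v ≡ (proj₁ v , negateIf (refl? γ) (proj₂ v))
  lin≡negateIf γ v with refl? γ
  ... | false = refl
  ... | true  = refl

  lin-∙ : ∀ γ δ v → lin (γ ∙ δ) v ≡ lin γ (lin δ v)
  lin-∙ γ δ v with refl? γ | refl? δ
  ... | false | false = refl
  ... | false | true  = refl
  ... | true  | false = refl
  ... | true  | true  = cong (proj₁ v ,_) (sym (-‿involutive _))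

  lin-+² : ∀ γ a b → lin γ (a +² b) ≡ lin γ a +² lin γ b
  lin-+² γ a b with refl? γ
  ... | false = refl
  ... | true  = cong (proj₁ a + proj₁ b ,_) (sym (-‿+-comm (proj₂ a) (proj₂ b)))

  lin-difference : ∀ γ a b → lin γ (a -² b) ≡ lin γ a -² lin γ b
  lin-difference γ a b with refl? γ
  ... | false = refl
  ... | true  = cong (proj₁ a + - proj₁ b ,_) (sym (-‿+-comm (proj₂ a) (- proj₂ b)))

  translation : Γ → ℝ²
  translation γ = (ιℤ (tx γ) , ιℤ (ty γ))

  translation-∙ : ∀ γ δ → translation (γ ∙ δ) ≡ lin γ (translation δ) +² translation γ
  translation-∙ ⟨ c , d , false ⟩ ⟨ c′ , d′ , _ ⟩ = cong₂ _,_ (ιℤ-+ c′ c) (ιℤ-+ d′ d)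
  translation-∙ ⟨ c , d , true  ⟩ ⟨ c′ , d′ , _ ⟩ =
    cong₂ _,_ (ιℤ-+ c′ c) (trans (ιℤ-+ (ℤ.- d′) d) (cong (_+ ιℤ d) (ιℤ-neg d′)))

  act-∙ : ∀ γ δ v → act (γ ∙ δ) v ≡ act γ (act δ v)
  act-∙ γ δ v = begin
    lin (γ ∙ δ) v +² translation (γ ∙ δ)
      ≡⟨ cong₂ _+²_ (lin-∙ γ δ v) (translation-∙ γ δ) ⟩
    lin γ (lin δ v) +² (lin γ (translation δ) +² translation γ)
      ≡⟨ cong₂ _,_ (+-assoc _ _ _) (+-assoc _ _ _) ⟨
    (lin γ (lin δ v) +² lin γ (translation δ)) +² translation γ
      ≡⟨ cong (_+² translation γ) (lin-+² γ (lin δ v) (translation δ)) ⟨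
    lin γ (act δ v) +² translation γ
      ∎
    where open ≡-Reasoning

  act-difference : ∀ γ a b → act γ a -² act γ b ≡ lin γ (a -² b)
  act-difference γ a b = trans (cong₂ _,_ ([x+t]-[y+t]≡x-y _ _ _) ([x+t]-[y+t]≡x-y _ _ _)) (sym (lin-difference γ a b))

  κ-cong-∣∣ : ∀ x y y′ → ∣ y ∣ ≡ ∣ y′ ∣ → κ (x , y) ≡ κ (x , y′)
  κ-cong-∣∣ x y y′ eq with compare ∣ x ∣ ∣ y ∣ | compare ∣ x ∣ ∣ y′ ∣
  ... | tri< _ _ _ | tri< _ _ _ = refl
  ... | tri≈ _ _ _ | tri≈ _ _ _ = refl
  ... | tri> _ _ _ | tri> _ _ _ = refl
  ... | tri< a _ _ | tri≈ _ b _ = ⊥-elim (irrefl (trans b (sym eq)) a)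
  ... | tri< a _ _ | tri> _ _ b = ⊥-elim (asym a (subst (_< ∣ x ∣) (sym eq) b))
  ... | tri≈ _ a _ | tri< b _ _ = ⊥-elim (irrefl (trans a eq) b)
  ... | tri≈ _ a _ | tri> _ _ b = ⊥-elim (irrefl (sym (trans a eq)) b)
  ... | tri> _ _ a | tri< b _ _ = ⊥-elim (asym a (subst (∣ x ∣ <_) (sym eq) b))
  ... | tri> _ _ a | tri≈ _ b _ = ⊥-elim (irrefl (sym (trans b (sym eq))) a)

  κ-lin : ∀ γ v → κ (lin γ v) ≡ κ v
  κ-lin γ v with refl? γ
  ... | false = refl
  ... | true  = κ-cong-∣∣ (proj₁ v) (- proj₂ v) (proj₂ v) (∣-x∣≡∣x∣ (proj₂ v))

  κ-values : ∀ v → κ v ≡ (1ℝ , 0ℝ) ⊎ κ v ≡ (0ℝ , 1ℝ) ⊎ κ v ≡ (0ℝ , 0ℝ)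
  κ-values (x , y) with compare ∣ x ∣ ∣ y ∣
  ... | tri< _ _ _ = inj₂ (inj₁ refl)
  ... | tri≈ _ _ _ = inj₂ (inj₂ refl)
  ... | tri> _ _ _ = inj₁ refl

module WalkCalculus {n m : ℕ} (G : GainGraph n m) where

  open import Data.Nat using (_≤_; _<_)

  open import Data.List.Membership.DecPropositional (Fin._≟_ {n}) using () renaming (_∈?_ to _∈ᵛ?_)
  open import Data.List.Membership.DecPropositional (Fin._≟_ {m}) using () renaming (_∈?_ to _∈ᵉ?_)

  EdgeSet : Set₁
  EdgeSet = Pred (Fin m) 0ℓ

  module _ {S : EdgeSet} where

    infixr 5 _++ʷ_
    _++ʷ_ : ∀ {a b c} → Walk G S a b → Walk G S b c → Walk G S a c
    []          ++ʷ q = q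
    fwd e s p   ++ʷ q = fwd e s (p ++ʷ q)
    bwd e s p   ++ʷ q = bwd e s (p ++ʷ q)

    reverse : ∀ {a b} → Walk G S a b → Walk G S b a
    reverse []          = []
    reverse (fwd e s w) = reverse w ++ʷ bwd e s []
    reverse (bwd e s w) = reverse w ++ʷ fwd e s []

    length-++ʷ : ∀ {a b c} (p : Walk G S a b) (q : Walk G S b c) →
                 length G (p ++ʷ q) ≡ length G p ℕ.+ length G q
    length-++ʷ []          q = refl
    length-++ʷ (fwd e s p) q = cong suc (length-++ʷ p q)
    length-++ʷ (bwd e s p) q = cong suc (length-++ʷ p q)

    walkEdges-++ʷ : ∀ {a b c} (p : Walk G S a b) (q : Walk G S b c) →
                    walkEdges G (p ++ʷ q) ≡ walkEdges G p ++ walkEdges G q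
    walkEdges-++ʷ []          q = refl
    walkEdges-++ʷ (fwd e s p) q = cong (e ∷_) (walkEdges-++ʷ p q)
    walkEdges-++ʷ (bwd e s p) q = cong (e ∷_) (walkEdges-++ʷ p q)

    walkEdges⊆ : ∀ {a b e} (w : Walk G S a b) → e ∈ walkEdges G w → S e
    walkEdges⊆ (fwd e s w) (here refl) = s
    walkEdges⊆ (fwd e s w) (there i)   = walkEdges⊆ w i
    walkEdges⊆ (bwd e s w) (here refl) = s
    walkEdges⊆ (bwd e s w) (there i)   = walkEdges⊆ w i

  restrict : ∀ {S T : EdgeSet} {a b} (w : Walk G S a b) → (∀ {e} → e ∈ walkEdges G w → T e) → Walk G T a b
  restrict []          t = []
  restrict (fwd e s w) t = fwd e (t (here refl)) (restrict w (t ∘ there))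
  restrict (bwd e s w) t = bwd e (t (here refl)) (restrict w (t ∘ there))

  walkEdges-restrict : ∀ {S T : EdgeSet} {a b} (w : Walk G S a b) (t : ∀ {e} → e ∈ walkEdges G w → T e) →
                       walkEdges G (restrict w t) ≡ walkEdges G w
  walkEdges-restrict []          t = refl
  walkEdges-restrict (fwd e s w) t = cong (e ∷_) (walkEdges-restrict w (t ∘ there))
  walkEdges-restrict (bwd e s w) t = cong (e ∷_) (walkEdges-restrict w (t ∘ there))

  walkVertices-restrict : ∀ {S T : EdgeSet} {a b} (w : Walk G S a b) (t : ∀ {e} → e ∈ walkEdges G w → T e) →
                          walkVertices G (restrict w t) ≡ walkVertices G w
  walkVertices-restrict []          t = refl
  walkVertices-restrict (fwd e s w) t = cong (tgt G e ∷_) (walkVertices-restrict w (t ∘ there))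
  walkVertices-restrict (bwd e s w) t = cong (src G e ∷_) (walkVertices-restrict w (t ∘ there))

  length-restrict : ∀ {S T : EdgeSet} {a b} (w : Walk G S a b) (t : ∀ {e} → e ∈ walkEdges G w → T e) →
                    length G (restrict w t) ≡ length G w
  length-restrict []          t = refl
  length-restrict (fwd e s w) t = cong suc (length-restrict w (t ∘ there))
  length-restrict (bwd e s w) t = cong suc (length-restrict w (t ∘ there))

  mapʷ : ∀ {S T : EdgeSet} → S ⊆ T → ∀ {a b} → Walk G S a b → Walk G T a b
  mapʷ S⊆T w = restrict w (S⊆T ∘ walkEdges⊆ w)

  parity : ∀ {S : EdgeSet} → (Fin m → Bool) → ∀ {a b} → Walk G S a b → Bool
  parity ω w = List.foldr (_xor_ ∘ ω) false (walkEdges G w)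

  parity-restrict : ∀ {S T : EdgeSet} ω {a b} (w : Walk G S a b) (t : ∀ {e} → e ∈ walkEdges G w → T e) →
                    parity ω (restrict w t) ≡ parity ω w
  parity-restrict ω w t = cong (List.foldr (_xor_ ∘ ω) false) (walkEdges-restrict w t)

  module _ {S : EdgeSet} (ω : Fin m → Bool) where

    parity-++ʷ : ∀ {a b c} (p : Walk G S a b) (q : Walk G S b c) →
                 parity ω (p ++ʷ q) ≡ parity ω p xor parity ω q
    parity-++ʷ []          q = refl
    parity-++ʷ (fwd e s p) q = trans (cong (ω e xor_) (parity-++ʷ p q)) (sym (Bool.xor-assoc (ω e) _ _))
    parity-++ʷ (bwd e s p) q = trans (cong (ω e xor_) (parity-++ʷ p q)) (sym (Bool.xor-assoc (ω e) _ _))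

    parity-reverse : ∀ {a b} (w : Walk G S a b) → parity ω (reverse w) ≡ parity ω w
    parity-reverse []          = refl
    parity-reverse (fwd e s w) = trans (parity-++ʷ (reverse w) (bwd e s []))
      (trans (cong₂ _xor_ (parity-reverse w) (Bool.xor-identityʳ (ω e))) (Bool.xor-comm (parity ω w) (ω e)))
    parity-reverse (bwd e s w) = trans (parity-++ʷ (reverse w) (fwd e s []))
      (trans (cong₂ _xor_ (parity-reverse w) (Bool.xor-identityʳ (ω e))) (Bool.xor-comm (parity ω w) (ω e)))

  Minimally : ∀ {ℓ} → (EdgeSet → Set ℓ) → EdgeSet → Set ℓ
  Minimally P S = P S × (∀ e → S e → ¬ P (S ∖ ｛ e ｝))

  without? : ∀ {S : EdgeSet} → Decidable S → ∀ e → Decidable (S ∖ ｛ e ｝)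
  without? S? e f = S? f ×-dec ¬? (e Fin.≟ f)

  Minimally-⇔ : ∀ {ℓ₁ ℓ₂} {P : EdgeSet → Set ℓ₁} {Q : EdgeSet → Set ℓ₂} →
                (∀ {T} → Decidable T → P T ⇔ Q T) → ∀ {S} → Decidable S → Minimally P S ⇔ Minimally Q S
  Minimally-⇔ P⇔Q S? = mk⇔
    (λ (pS , minimal) → Equivalence.to (P⇔Q S?) pS , λ e s qS∖e → minimal e s (Equivalence.from (P⇔Q (without? S? e)) qS∖e))
    (λ (qS , minimal) → Equivalence.from (P⇔Q S?) qS , λ e s pS∖e → minimal e s (Equivalence.to (P⇔Q (without? S? e)) pS∖e))

  reflects : Fin m → Bool
  reflects e = refl? (gain G e)

  refl?-netGain : ∀ {S : EdgeSet} {a b} (w : Walk G S a b) → refl? (netGain G w) ≡ parity reflects w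
  refl?-netGain []          = refl
  refl?-netGain (fwd e s w) = cong (reflects e xor_) (refl?-netGain w)
  refl?-netGain (bwd e s w) = cong (reflects e xor_) (refl?-netGain w)

  module _ {S : EdgeSet} where

    splitAtVertex : ∀ {a b x} (w : Walk G S a b) → x ∈ walkVertices G w →
      Σ (Walk G S a x) λ p → Σ (Walk G S x b) λ q → w ≡ p ++ʷ q × 0 < length G p
    splitAtVertex (fwd e s w) (here refl) = fwd e s [] , w , refl , s≤s z≤n
    splitAtVertex (bwd e s w) (here refl) = bwd e s [] , w , refl , s≤s z≤n
    splitAtVertex (fwd e s w) (there i) with splitAtVertex w i
    ... | p , q , refl , _ = fwd e s p , q , refl , s≤s z≤n
    splitAtVertex (bwd e s w) (there i) with splitAtVertex w i
    ... | p , q , refl , _ = bwd e s p , q , refl , s≤s z≤n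

    data EdgeOccurrence {a b} (w : Walk G S a b) (e : Fin m) : Set where
      forward  : (s : S e) (p : Walk G S a (src G e)) (q : Walk G S (tgt G e) b) →
                 w ≡ p ++ʷ fwd e s q → EdgeOccurrence w e
      backward : (s : S e) (p : Walk G S a (tgt G e)) (q : Walk G S (src G e) b) →
                 w ≡ p ++ʷ bwd e s q → EdgeOccurrence w e

    splitAtEdge : ∀ {a b e} (w : Walk G S a b) → e ∈ walkEdges G w → EdgeOccurrence w e
    splitAtEdge (fwd e s w) (here refl) = forward s [] w refl
    splitAtEdge (bwd e s w) (here refl) = backward s [] w refl
    splitAtEdge (fwd f s w) (there i) with splitAtEdge w i
    ... | forward  s′ p q refl = forward  s′ (fwd f s p) q refl
    ... | backward s′ p q refl = backward s′ (fwd f s p) q refl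
    splitAtEdge (bwd f s w) (there i) with splitAtEdge w i
    ... | forward  s′ p q refl = forward  s′ (bwd f s p) q refl
    ... | backward s′ p q refl = backward s′ (bwd f s p) q refl

    length-++ʷ³ : ∀ {a b c d} (h : Walk G S a b) (p : Walk G S b c) (q : Walk G S c d) →
                  length G (h ++ʷ p ++ʷ q) ≡ length G h ℕ.+ (length G p ℕ.+ length G q)
    length-++ʷ³ h p q = trans (length-++ʷ h (p ++ʷ q)) (cong (length G h ℕ.+_) (length-++ʷ p q))

    parity-++ʷ³ : ∀ ω {a b c d} (h : Walk G S a b) (p : Walk G S b c) (q : Walk G S c d) →
                  parity ω (h ++ʷ p ++ʷ q) ≡ parity ω h xor (parity ω p xor parity ω q)
    parity-++ʷ³ ω h p q = trans (parity-++ʷ ω h (p ++ʷ q)) (cong (parity ω h xor_) (parity-++ʷ ω p q))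

    record LoopSplit {a b} (w : Walk G S a b) : Set where
      field
        junction     : Fin n
        toLoop       : Walk G S a junction
        loop         : Walk G S junction junction
        rest         : Walk G S a b
        loop-shorter : length G loop < length G w
        rest-shorter : length G rest < length G w
        parity-split : ∀ ω → parity ω w ≡ parity ω loop xor parity ω rest

    ++ʷ-nonempty : ∀ {a b c} (h : Walk G S a b) (q : Walk G S b c) → 0 < length G h → 0 < length G (h ++ʷ q)
    ++ʷ-nonempty h q 0<h = subst (0 <_) (sym (length-++ʷ h q)) (ℕ.<-≤-trans 0<h (ℕ.m≤m+n _ _))

    prepend : ∀ {a a′ b} (h : Walk G S a a′) {w : Walk G S a′ b} → LoopSplit w → LoopSplit (h ++ʷ w)
    prepend h {w} d = record
      { junction = junction ; toLoop = h ++ʷ toLoop ; loop = loop ; rest = h ++ʷ rest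
      ; loop-shorter = let open ℕ.≤-Reasoning in begin-strict
          length G loop               <⟨ loop-shorter ⟩
          length G w                  ≤⟨ ℕ.m≤n+m _ (length G h) ⟩
          length G h ℕ.+ length G w   ≡⟨ length-++ʷ h w ⟨
          length G (h ++ʷ w)          ∎
      ; rest-shorter = let open ℕ.≤-Reasoning in begin-strict
          length G (h ++ʷ rest)          ≡⟨ length-++ʷ h rest ⟩
          length G h ℕ.+ length G rest   <⟨ ℕ.+-monoʳ-< (length G h) rest-shorter ⟩
          length G h ℕ.+ length G w      ≡⟨ length-++ʷ h w ⟨
          length G (h ++ʷ w)             ∎
      ; parity-split = λ ω → let open ≡-Reasoning in begin
          parity ω (h ++ʷ w)                               ≡⟨ parity-++ʷ ω h w ⟩
          parity ω h xor parity ω w                        ≡⟨ cong (parity ω h xor_) (parity-split ω) ⟩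
          parity ω h xor (parity ω loop xor parity ω rest) ≡⟨ xor-leftComm (parity ω h) (parity ω loop) (parity ω rest) ⟩
          parity ω loop xor (parity ω h xor parity ω rest) ≡⟨ cong (parity ω loop xor_) (parity-++ʷ ω h rest) ⟨
          parity ω loop xor parity ω (h ++ʷ rest)          ∎ }
      where open LoopSplit d

    revisit : ∀ {a a′ b} (h : Walk G S a a′) (p : Walk G S a′ a′) (q : Walk G S a′ b) →
              0 < length G h → 0 < length G p → LoopSplit (h ++ʷ p ++ʷ q)
    revisit h p q 0<h 0<p = record
      { junction = _ ; toLoop = h ; loop = p ; rest = h ++ʷ q
      ; loop-shorter = let open ℕ.≤-Reasoning in begin-strict
          length G p                                    <⟨ ℕ.m<n+m _ 0<h ⟩
          length G h ℕ.+ length G p                     ≤⟨ ℕ.+-monoʳ-≤ (length G h) (ℕ.m≤m+n _ _) ⟩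
          length G h ℕ.+ (length G p ℕ.+ length G q)    ≡⟨ length-++ʷ³ h p q ⟨
          length G (h ++ʷ p ++ʷ q)                      ∎
      ; rest-shorter = let open ℕ.≤-Reasoning in begin-strict
          length G (h ++ʷ q)                            ≡⟨ length-++ʷ h q ⟩
          length G h ℕ.+ length G q                     <⟨ ℕ.+-monoʳ-< (length G h) (ℕ.m<n+m _ 0<p) ⟩
          length G h ℕ.+ (length G p ℕ.+ length G q)    ≡⟨ length-++ʷ³ h p q ⟨
          length G (h ++ʷ p ++ʷ q)                      ∎
      ; parity-split = λ ω → let open ≡-Reasoning in begin
          parity ω (h ++ʷ p ++ʷ q)                      ≡⟨ parity-++ʷ³ ω h p q ⟩
          parity ω h xor (parity ω p xor parity ω q)    ≡⟨ xor-leftComm (parity ω h) (parity ω p) (parity ω q) ⟩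
          parity ω p xor (parity ω h xor parity ω q)    ≡⟨ cong (parity ω p xor_) (parity-++ʷ ω h q) ⟨
          parity ω p xor parity ω (h ++ʷ q)             ∎ }

    repeatForward : ∀ {a a′ b} (h h′ : Walk G S a a′) (p : Walk G S a′ a) (q : Walk G S a′ b) →
                    0 < length G h → 0 < length G h′ → (∀ ω → parity ω h′ ≡ parity ω h) →
                    LoopSplit (h ++ʷ p ++ʷ h′ ++ʷ q)
    repeatForward h h′ p q 0<h 0<h′ h′≈h = record
      { junction = _ ; toLoop = [] ; loop = h ++ʷ p ; rest = h′ ++ʷ q
      ; loop-shorter = let open ℕ.≤-Reasoning in begin-strict
          length G (h ++ʷ p)                                       ≡⟨ length-++ʷ h p ⟩
          length G h ℕ.+ length G p
            <⟨ ℕ.+-monoʳ-< (length G h) (ℕ.m<m+n _ (++ʷ-nonempty h′ q 0<h′)) ⟩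
          length G h ℕ.+ (length G p ℕ.+ length G (h′ ++ʷ q))      ≡⟨ length-++ʷ³ h p (h′ ++ʷ q) ⟨
          length G (h ++ʷ p ++ʷ h′ ++ʷ q)                          ∎
      ; rest-shorter = let open ℕ.≤-Reasoning in begin-strict
          length G (h′ ++ʷ q)                                      <⟨ ℕ.m<n+m _ 0<h ⟩
          length G h ℕ.+ length G (h′ ++ʷ q)
            ≤⟨ ℕ.+-monoʳ-≤ (length G h) (ℕ.m≤n+m _ _) ⟩
          length G h ℕ.+ (length G p ℕ.+ length G (h′ ++ʷ q))      ≡⟨ length-++ʷ³ h p (h′ ++ʷ q) ⟨
          length G (h ++ʷ p ++ʷ h′ ++ʷ q)                          ∎
      ; parity-split = λ ω → let open ≡-Reasoning in begin
          parity ω (h ++ʷ p ++ʷ h′ ++ʷ q)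
            ≡⟨ parity-++ʷ³ ω h p (h′ ++ʷ q) ⟩
          parity ω h xor (parity ω p xor parity ω (h′ ++ʷ q))
            ≡⟨ Bool.xor-assoc (parity ω h) (parity ω p) (parity ω (h′ ++ʷ q)) ⟨
          (parity ω h xor parity ω p) xor parity ω (h′ ++ʷ q)
            ≡⟨ cong (_xor parity ω (h′ ++ʷ q)) (parity-++ʷ ω h p) ⟨
          parity ω (h ++ʷ p) xor parity ω (h′ ++ʷ q) ∎ }

    repeatBackward : ∀ {a a′ b} (h : Walk G S a a′) (p : Walk G S a′ a′) (h′ : Walk G S a′ a) (q : Walk G S a b) →
                     0 < length G h → (∀ ω → parity ω h′ ≡ parity ω h) →
                     LoopSplit (h ++ʷ p ++ʷ h′ ++ʷ q)
    repeatBackward h p h′ q 0<h h′≈h = record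
      { junction = _ ; toLoop = h ; loop = p ; rest = q
      ; loop-shorter = let open ℕ.≤-Reasoning in begin-strict
          length G p                                               <⟨ ℕ.m<n+m _ 0<h ⟩
          length G h ℕ.+ length G p                                ≤⟨ ℕ.+-monoʳ-≤ (length G h) (ℕ.m≤m+n _ _) ⟩
          length G h ℕ.+ (length G p ℕ.+ length G (h′ ++ʷ q))      ≡⟨ length-++ʷ³ h p (h′ ++ʷ q) ⟨
          length G (h ++ʷ p ++ʷ h′ ++ʷ q)                          ∎
      ; rest-shorter = let open ℕ.≤-Reasoning in begin-strict
          length G q                                               <⟨ ℕ.m<n+m _ 0<h ⟩
          length G h ℕ.+ length G q
            ≤⟨ ℕ.+-monoʳ-≤ (length G h) (ℕ.≤-trans (ℕ.m≤n+m _ (length G h′)) (ℕ.m≤n+m _ (length G p))) ⟩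
          length G h ℕ.+ (length G p ℕ.+ (length G h′ ℕ.+ length G q))
            ≡⟨ cong (λ k → length G h ℕ.+ (length G p ℕ.+ k)) (length-++ʷ h′ q) ⟨
          length G h ℕ.+ (length G p ℕ.+ length G (h′ ++ʷ q))      ≡⟨ length-++ʷ³ h p (h′ ++ʷ q) ⟨
          length G (h ++ʷ p ++ʷ h′ ++ʷ q)                          ∎
      ; parity-split = λ ω → let open ≡-Reasoning in begin
          parity ω (h ++ʷ p ++ʷ h′ ++ʷ q)
            ≡⟨ parity-++ʷ³ ω h p (h′ ++ʷ q) ⟩
          parity ω h xor (parity ω p xor parity ω (h′ ++ʷ q))
            ≡⟨ cong (λ z → parity ω h xor (parity ω p xor z)) (parity-++ʷ ω h′ q) ⟩
          parity ω h xor (parity ω p xor (parity ω h′ xor parity ω q))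
            ≡⟨ cong (λ z → parity ω h xor (parity ω p xor (z xor parity ω q))) (h′≈h ω) ⟩
          parity ω h xor (parity ω p xor (parity ω h xor parity ω q))
            ≡⟨ xor-cancel-middle (parity ω h) (parity ω p) (parity ω q) ⟩
          parity ω p xor parity ω q ∎ }

    vertexUnique-or-loop : ∀ {a b} (w : Walk G S a b) → Unique (walkVertices G w) ⊎ LoopSplit w
    vertexUnique-or-loop [] = inj₁ []
    vertexUnique-or-loop (fwd e s w) with vertexUnique-or-loop w
    ... | inj₂ d = inj₂ (prepend (fwd e s []) d)
    ... | inj₁ u with tgt G e ∈ᵛ? walkVertices G w
    ...   | no  v∉ = inj₁ (¬Any⇒All¬ _ v∉ ∷ u)
    ...   | yes v∈ with splitAtVertex w v∈
    ...     | p , q , refl , 0<p = inj₂ (revisit (fwd e s []) p q (s≤s z≤n) 0<p)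
    vertexUnique-or-loop (bwd e s w) with vertexUnique-or-loop w
    ... | inj₂ d = inj₂ (prepend (bwd e s []) d)
    ... | inj₁ u with src G e ∈ᵛ? walkVertices G w
    ...   | no  v∉ = inj₁ (¬Any⇒All¬ _ v∉ ∷ u)
    ...   | yes v∈ with splitAtVertex w v∈
    ...     | p , q , refl , 0<p = inj₂ (revisit (bwd e s []) p q (s≤s z≤n) 0<p)

    edgeUnique-or-loop : ∀ {a b} (w : Walk G S a b) → Unique (walkEdges G w) ⊎ LoopSplit w
    edgeUnique-or-loop [] = inj₁ []
    edgeUnique-or-loop (fwd e s w) with edgeUnique-or-loop w
    ... | inj₂ d = inj₂ (prepend (fwd e s []) d)
    ... | inj₁ u with e ∈ᵉ? walkEdges G w
    ...   | no  e∉ = inj₁ (¬Any⇒All¬ _ e∉ ∷ u)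
    ...   | yes e∈ with splitAtEdge w e∈
    ...     | forward  s′ p q refl = inj₂ (repeatForward (fwd e s []) (fwd e s′ []) p q (s≤s z≤n) (s≤s z≤n) λ _ → refl)
    ...     | backward s′ p q refl = inj₂ (repeatBackward (fwd e s []) p (bwd e s′ []) q (s≤s z≤n) λ _ → refl)
    edgeUnique-or-loop (bwd e s w) with edgeUnique-or-loop w
    ... | inj₂ d = inj₂ (prepend (bwd e s []) d)
    ... | inj₁ u with e ∈ᵉ? walkEdges G w
    ...   | no  e∉ = inj₁ (¬Any⇒All¬ _ e∉ ∷ u)
    ...   | yes e∈ with splitAtEdge w e∈
    ...     | forward  s′ p q refl = inj₂ (repeatBackward (bwd e s []) p (fwd e s′ []) q (s≤s z≤n) λ _ → refl)
    ...     | backward s′ p q refl = inj₂ (repeatForward (bwd e s []) (bwd e s′ []) p q (s≤s z≤n) (s≤s z≤n) λ _ → refl)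

    record OddCycleFrom (ω : Fin m → Bool) (a : Fin n) : Set where
      field
        cycle : Cycle G S
        reach : Walk G S a (Cycle.base cycle)
        odd   : parity ω (Cycle.walk cycle) ≡ true

    odd⇒nonempty : ∀ ω {a b} (w : Walk G S a b) → parity ω w ≡ true → 0 < length G w
    odd⇒nonempty ω (fwd e s w) _ = s≤s z≤n
    odd⇒nonempty ω (bwd e s w) _ = s≤s z≤n

    oddCycle : ∀ ω {a} (c : Walk G S a a) → parity ω c ≡ true → OddCycleFrom ω a
    oddCycle ω c odd = go (length G c) c ℕ.≤-refl odd
      where
      go : ∀ k {a} (c : Walk G S a a) → length G c ≤ k → parity ω c ≡ true → OddCycleFrom ω a
      shorten : ∀ k {a} (c : Walk G S a a) → length G c ≤ suc k → parity ω c ≡ true → LoopSplit c → OddCycleFrom ω a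

      go zero    c c≤0 odd = ⊥-elim (ℕ.n≮0 (ℕ.<-≤-trans (odd⇒nonempty ω c odd) c≤0))
      go (suc k) c c≤k odd with vertexUnique-or-loop c | edgeUnique-or-loop c
      ... | inj₂ d  | _       = shorten k c c≤k odd d
      ... | inj₁ _  | inj₂ d  = shorten k c c≤k odd d
      ... | inj₁ uv | inj₁ ue = record
        { cycle = record { base = _ ; walk = c ; nonempty = odd⇒nonempty ω c odd
                         ; edges-distinct = ue ; vertices-distinct = uv }
        ; reach = [] ; odd = odd }

      shorten k {a} c c≤k odd d = byLoopParity (parity ω loop) refl
        where
        open LoopSplit d
        byLoopParity : ∀ b → parity ω loop ≡ b → OddCycleFrom ω a
        byLoopParity true  loop-odd = record { OddCycleFrom C ; reach = toLoop ++ʷ OddCycleFrom.reach C }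
          where C = go k loop (ℕ.≤-pred (ℕ.≤-trans loop-shorter c≤k)) loop-odd
        byLoopParity false loop-even = go k rest (ℕ.≤-pred (ℕ.≤-trans rest-shorter c≤k))
          (trans (sym (cong (_xor parity ω rest) loop-even)) (trans (sym (parity-split ω)) odd))

    length≡vertexCount : ∀ {a b} (w : Walk G S a b) → length G w ≡ List.length (walkVertices G w)
    length≡vertexCount []          = refl
    length≡vertexCount (fwd e s w) = cong suc (length≡vertexCount w)
    length≡vertexCount (bwd e s w) = cong suc (length≡vertexCount w)

    walkWithin : ∀ {a b} (w : Walk G S a b) → Σ (Walk G S a b) λ w′ → length G w′ ≤ n
    walkWithin w = go (length G w) w ℕ.≤-refl
      where
      go : ∀ k {a b} (w : Walk G S a b) → length G w ≤ k → Σ (Walk G S a b) λ w′ → length G w′ ≤ n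
      go k w w≤k with vertexUnique-or-loop w
      ... | inj₁ u = w , subst (_≤ n) (sym (length≡vertexCount w)) (unique⇒length≤ u)
      go zero    w w≤0 | inj₂ d = ⊥-elim (ℕ.n≮0 (ℕ.<-≤-trans (LoopSplit.rest-shorter d) w≤0))
      go (suc k) w w≤k | inj₂ d = go k (LoopSplit.rest d) (ℕ.≤-pred (ℕ.≤-trans (LoopSplit.rest-shorter d) w≤k))

    Balanced : (Fin m → Bool) → Fin n → Set
    Balanced ω r = ∀ {v} (w₁ w₂ : Walk G S r v) → parity ω w₁ ≡ parity ω w₂

    UnbalancedAt : (Fin m → Bool) → Fin n → Set
    UnbalancedAt ω r = Σ (Walk G S r r) λ c → parity ω c ≡ true

  module Reachability {S : EdgeSet} (S? : Decidable S) where

    WalkWithin : ℕ → Fin n → Fin n → Set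
    WalkWithin k a b = Σ (Walk G S a b) λ w → length G w ≤ k

    FirstStep : ℕ → Fin n → Fin n → Fin m → Set
    FirstStep k a b e = S e × ((src G e ≡ a × WalkWithin k (tgt G e) b) ⊎ (tgt G e ≡ a × WalkWithin k (src G e) b))

    walkWithin? : ∀ k a b → Dec (WalkWithin k a b)
    walkWithin? zero    a b = map′ (λ { refl → [] , z≤n }) (λ { ([] , _) → refl }) (a Fin.≟ b)
    walkWithin? (suc k) a b = map′ fromStep toStep ((a Fin.≟ b) ⊎-dec Fin.any? λ e →
        S? e ×-dec (((src G e Fin.≟ a) ×-dec walkWithin? k (tgt G e) b) ⊎-dec ((tgt G e Fin.≟ a) ×-dec walkWithin? k (src G e) b)))
      where
      fromStep : a ≡ b ⊎ ∃ (FirstStep k a b) → WalkWithin (suc k) a b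
      fromStep (inj₁ refl)                           = [] , z≤n
      fromStep (inj₂ (e , s , inj₁ (refl , w , ≤k))) = fwd e s w , s≤s ≤k
      fromStep (inj₂ (e , s , inj₂ (refl , w , ≤k))) = bwd e s w , s≤s ≤k
      toStep : WalkWithin (suc k) a b → a ≡ b ⊎ ∃ (FirstStep k a b)
      toStep ([] , _)               = inj₁ refl
      toStep (fwd e s w , s≤s ≤k)   = inj₂ (e , s , inj₁ (refl , w , ≤k))
      toStep (bwd e s w , s≤s ≤k)   = inj₂ (e , s , inj₂ (refl , w , ≤k))

    walk? : ∀ a b → Dec (Walk G S a b)
    walk? a b = map′ proj₁ walkWithin (walkWithin? n a b)

    -- Label each vertex by the parity of some walk from r: if every edge respects the labels, all walks
    -- r ⇝ v have the parity of v's label; an edge violating them closes an odd walk at r.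
    module _ (ω : Fin m → Bool) (r : Fin n) where

      private
        label : Fin n → Bool
        label v with walk? r v
        ... | yes w = parity ω w
        ... | no  _ = false

        labelWitness : ∀ {v} → Walk G S r v → Σ (Walk G S r v) λ w → label v ≡ parity ω w
        labelWitness {v} w with walk? r v
        ... | yes w′ = w′ , refl
        ... | no  ¬w = ⊥-elim (¬w w)

        Conflict : Fin m → Set
        Conflict e = S e × Walk G S r (src G e) × ¬ label (src G e) ≡ ω e xor label (tgt G e)

        consistent : (∀ e → ¬ Conflict e) → ∀ e → S e → Walk G S r (src G e) → label (src G e) ≡ ω e xor label (tgt G e)
        consistent noConflict e s P = decidable-stable (label (src G e) Bool.≟ _) λ ≢ → noConflict e (s , P , ≢)

        labels-propagate : (∀ e → ¬ Conflict e) →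
                           ∀ {a v} → Walk G S r a → (w : Walk G S a v) → label a xor parity ω w ≡ label v
        labels-propagate _         _ []          = Bool.xor-identityʳ _
        labels-propagate noConflict P (fwd e s w) = begin
          label (src G e) xor (ω e xor parity ω w)                ≡⟨ cong (_xor (ω e xor parity ω w)) (consistent noConflict e s P) ⟩
          (ω e xor label (tgt G e)) xor (ω e xor parity ω w)      ≡⟨ Bool.xor-assoc (ω e) _ _ ⟩
          ω e xor (label (tgt G e) xor (ω e xor parity ω w))      ≡⟨ xor-cancel-middle (ω e) (label (tgt G e)) (parity ω w) ⟩
          label (tgt G e) xor parity ω w                          ≡⟨ labels-propagate noConflict (P ++ʷ fwd e s []) w ⟩
          label _                                                 ∎
          where
          open ≡-Reasoning
        labels-propagate noConflict P (bwd e s w) = begin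
          label (tgt G e) xor (ω e xor parity ω w)                ≡⟨ Bool.xor-assoc (label (tgt G e)) _ _ ⟨
          (label (tgt G e) xor ω e) xor parity ω w                ≡⟨ cong (_xor parity ω w) (Bool.xor-comm (label (tgt G e)) (ω e)) ⟩
          (ω e xor label (tgt G e)) xor parity ω w                ≡⟨ cong (_xor parity ω w) (sym (consistent noConflict e s P′)) ⟩
          label (src G e) xor parity ω w                          ≡⟨ labels-propagate noConflict P′ w ⟩
          label _                                                 ∎
          where
          open ≡-Reasoning
          P′ = P ++ʷ bwd e s []

        conflict⇒unbalanced : ∀ {e} → Conflict e → UnbalancedAt ω r
        conflict⇒unbalanced {e} (s , P , ≢) = P₁ ++ʷ fwd e s (reverse P₂) , (begin
          parity ω (P₁ ++ʷ fwd e s (reverse P₂))                   ≡⟨ parity-++ʷ ω P₁ _ ⟩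
          parity ω P₁ xor (ω e xor parity ω (reverse P₂))          ≡⟨ cong (λ z → parity ω P₁ xor (ω e xor z)) (parity-reverse ω P₂) ⟩
          parity ω P₁ xor (ω e xor parity ω P₂)                    ≡⟨ cong₂ (λ a b → a xor (ω e xor b)) (sym eq₁) (sym eq₂) ⟩
          label (src G e) xor (ω e xor label (tgt G e))            ≡⟨ ≢⇒xor≡true ≢ ⟩
          true                                                     ∎)
          where
          open ≡-Reasoning
          P₁ = proj₁ (labelWitness P)
          eq₁ = proj₂ (labelWitness P)
          P₂ = proj₁ (labelWitness (P ++ʷ fwd e s []))
          eq₂ = proj₂ (labelWitness (P ++ʷ fwd e s []))

      balanced-or-unbalanced : Balanced ω r ⊎ UnbalancedAt ω r
      balanced-or-unbalanced with Fin.any? (λ e → S? e ×-dec walk? r (src G e) ×-dec ¬? (label (src G e) Bool.≟ _))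
      ... | yes (e , conflict) = inj₂ (conflict⇒unbalanced conflict)
      ... | no  noConflict     = inj₁ λ w₁ w₂ → xor-cancelˡ (label r)
              (trans (labels-propagate noConflict′ [] w₁) (sym (labels-propagate noConflict′ [] w₂)))
        where noConflict′ = λ e c → noConflict (e , c)

  mapᶜ : ∀ {S T : EdgeSet} → S ⊆ T → Cycle G S → Cycle G T
  mapᶜ S⊆T C = record
    { base = base
    ; walk = mapʷ S⊆T walk
    ; nonempty = subst (0 <_) (sym (length-restrict walk _)) nonempty
    ; edges-distinct = subst Unique (sym (walkEdges-restrict walk _)) edges-distinct
    ; vertices-distinct = subst Unique (sym (walkVertices-restrict walk _)) vertices-distinct }
    where open Cycle C

  indicator : Fin m → Fin m → Bool
  indicator e f = does (e Fin.≟ f)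

  module _ {S : EdgeSet} where

    avoiding : ∀ {e a b} (w : Walk G S a b) → e ∉ walkEdges G w → Walk G (S ∖ ｛ e ｝) a b
    avoiding w e∉ = restrict w λ f∈ → walkEdges⊆ w f∈ , λ { refl → e∉ f∈ }

    parity-avoiding : ∀ ω {e a b} (w : Walk G S a b) (e∉ : e ∉ walkEdges G w) → parity ω (avoiding w e∉) ≡ parity ω w
    parity-avoiding ω w e∉ = parity-restrict ω w _

    bypass : ∀ {e} → Walk G (S ∖ ｛ e ｝) (tgt G e) (src G e) → ∀ {a b} → Walk G S a b → Walk G (S ∖ ｛ e ｝) a b
    bypass d [] = []
    bypass {e} d (fwd f s w) with e Fin.≟ f
    ... | yes refl = reverse d ++ʷ bypass d w
    ... | no  e≢f  = fwd f (s , e≢f) (bypass d w)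
    bypass {e} d (bwd f s w) with e Fin.≟ f
    ... | yes refl = d ++ʷ bypass d w
    ... | no  e≢f  = bwd f (s , e≢f) (bypass d w)

    parity-rotate : ∀ ω x {a b c} (q : Walk G S a b) (p : Walk G S b c) →
                    parity ω (q ++ʷ p) ≡ x xor (parity ω p xor (x xor parity ω q))
    parity-rotate ω x q p = begin
      parity ω (q ++ʷ p)                               ≡⟨ parity-++ʷ ω q p ⟩
      parity ω q xor parity ω p                        ≡⟨ Bool.xor-comm (parity ω q) (parity ω p) ⟩
      parity ω p xor parity ω q                        ≡⟨ xor-cancel-middle x (parity ω p) (parity ω q) ⟨
      x xor (parity ω p xor (x xor parity ω q))        ∎
      where open ≡-Reasoning

    record Detour (C : Cycle G S) (e : Fin m) : Set where
      field
        detour        : Walk G (S ∖ ｛ e ｝) (tgt G e) (src G e)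
        detour-parity : ∀ ω → parity ω detour ≡ ω e xor parity ω (Cycle.walk C)

    cycleDetour : (C : Cycle G S) → ∀ {e} → e ∈ walkEdges G (Cycle.walk C) → Detour C e
    cycleDetour C {e} e∈ with splitAtEdge (Cycle.walk C) e∈ | Cycle.edges-distinct C
    ... | forward s p q refl | distinct = record
      { detour = avoiding (q ++ʷ p) e∉
      ; detour-parity = λ ω → trans (parity-avoiding ω (q ++ʷ p) e∉)
                                (trans (parity-rotate ω (ω e) q p) (cong (ω e xor_) (sym (parity-++ʷ ω p (fwd e s q))))) }
      where
      e∉ : e ∉ walkEdges G (q ++ʷ p)
      e∉ = subst (e ∉_) (sym (walkEdges-++ʷ q p)) (unique-rotate (walkEdges G p) (subst Unique (walkEdges-++ʷ p _) distinct))
    ... | backward s p q refl | distinct = record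
      { detour = reverse (avoiding (q ++ʷ p) e∉)
      ; detour-parity = λ ω → trans (parity-reverse ω (avoiding (q ++ʷ p) e∉))
                                (trans (parity-avoiding ω (q ++ʷ p) e∉)
                                  (trans (parity-rotate ω (ω e) q p) (cong (ω e xor_) (sym (parity-++ʷ ω p (bwd e s q)))))) }
      where
      e∉ : e ∉ walkEdges G (q ++ʷ p)
      e∉ = subst (e ∉_) (sym (walkEdges-++ʷ q p)) (unique-rotate (walkEdges G p) (subst Unique (walkEdges-++ʷ p _) distinct))

    indicator-avoiding : ∀ {e a b} (w : Walk G (S ∖ ｛ e ｝) a b) → parity (indicator e) w ≡ false
    indicator-avoiding []               = refl
    indicator-avoiding (fwd f (_ , e≢f) w) = cong₂ _xor_ (dec-false (_ Fin.≟ f) e≢f) (indicator-avoiding w)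
    indicator-avoiding (bwd f (_ , e≢f) w) = cong₂ _xor_ (dec-false (_ Fin.≟ f) e≢f) (indicator-avoiding w)

    indicator-odd⇒∈ : ∀ {e a b} (w : Walk G S a b) → parity (indicator e) w ≡ true → e ∈ walkEdges G w
    indicator-odd⇒∈ {e} (fwd f s w) odd with e Fin.≟ f
    ... | yes refl = here refl
    ... | no  _    = there (indicator-odd⇒∈ w odd)
    indicator-odd⇒∈ {e} (bwd f s w) odd with e Fin.≟ f
    ... | yes refl = here refl
    ... | no  _    = there (indicator-odd⇒∈ w odd)

    -- P closed up by e uses e exactly once, so a cycle that is odd for the indicator of e contains e.
    cycleThrough : ∀ {e} → S e → Walk G (S ∖ ｛ e ｝) (src G e) (tgt G e) →
                   Σ (Cycle G S) λ C → Walk G S (src G e) (Cycle.base C) × e ∈ walkEdges G (Cycle.walk C)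
    cycleThrough {e} s P = cycle , reach , indicator-odd⇒∈ (Cycle.walk cycle) odd
      where
      P′ = mapʷ proj₁ P
      closed-odd : parity (indicator e) (P′ ++ʷ bwd e s []) ≡ true
      closed-odd = begin
        parity (indicator e) (P′ ++ʷ bwd e s [])                   ≡⟨ parity-++ʷ (indicator e) P′ (bwd e s []) ⟩
        parity (indicator e) P′ xor (indicator e e xor false)
          ≡⟨ cong₂ _xor_ (trans (parity-restrict (indicator e) P _) (indicator-avoiding P))
                         (trans (Bool.xor-identityʳ _) (dec-true (e Fin.≟ e) refl)) ⟩
        true                                                       ∎
        where open ≡-Reasoning
      open OddCycleFrom (oddCycle (indicator e) (P′ ++ʷ bwd e s []) closed-odd)

  module _ {S : EdgeSet} (S? : Decidable S) where
    open Reachability S?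

    unbalanced⇔notPurelyPeriodic : ∀ r → UnbalancedAt {S} reflects r ⇔ (¬ ComponentPurelyPeriodic G S r)
    unbalanced⇔notPurelyPeriodic r = mk⇔ unbalanced⇒notPP notPP⇒unbalanced
      where
      unbalanced⇒notPP : UnbalancedAt reflects r → ¬ ComponentPurelyPeriodic G S r
      unbalanced⇒notPP (c , odd) pp with trans (refl?-netGain c) odd | pp r [] (netGain G c) (gen c)
      ... | reflecting | translation = case trans (sym reflecting) translation of λ ()

      balanced⇒translations : Balanced reflects r → ∀ {w} → Walk G S r w →
                              ∀ {g} → _∈GainSpace_at_ G g S w → IsTranslation g
      balanced⇒translations bal P (gen c)   = trans (refl?-netGain c)
        (xor-cancelˡ (parity reflects P) (trans (sym (parity-++ʷ reflects P c)) (trans (bal (P ++ʷ c) P) (sym (Bool.xor-identityʳ _)))))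
      balanced⇒translations bal P unit      = refl
      balanced⇒translations bal P (mul g h) = cong₂ _xor_ (balanced⇒translations bal P g) (balanced⇒translations bal P h)
      balanced⇒translations bal P (inv g)   = balanced⇒translations bal P g

      notPP⇒unbalanced : ¬ ComponentPurelyPeriodic G S r → UnbalancedAt reflects r
      notPP⇒unbalanced notPP with balanced-or-unbalanced reflects r
      ... | inj₁ bal = ⊥-elim (notPP λ w P g → balanced⇒translations bal P)
      ... | inj₂ unbal = unbal

  module _ {S : EdgeSet} where

    firstEdge : (C : Cycle G S) →
      Σ (Fin m) λ f → f ∈ walkEdges G (Cycle.walk C) × (Cycle.base C ≡ src G f ⊎ Cycle.base C ≡ tgt G f)
    firstEdge record { walk = fwd f _ _ } = f , here refl , inj₁ refl
    firstEdge record { walk = bwd f _ _ } = f , here refl , inj₂ refl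

    reachEndpoints : (C : Cycle G S) → ∀ {f} → f ∈ walkEdges G (Cycle.walk C) →
      Walk G S (Cycle.base C) (src G f) × Walk G S (Cycle.base C) (tgt G f)
    reachEndpoints C f∈ with splitAtEdge (Cycle.walk C) f∈
    ... | forward  s p q _ = p , p ++ʷ fwd _ s []
    ... | backward s p q _ = p ++ʷ bwd _ s [] , p

    reachBaseThrough : (C D : Cycle G S) → (∀ {f} → f ∈ walkEdges G (Cycle.walk D) → f ∈ walkEdges G (Cycle.walk C)) →
      Walk G S (Cycle.base C) (Cycle.base D)
    reachBaseThrough C D D⊆C with firstEdge D
    ... | f , f∈ , inj₁ refl = proj₁ (reachEndpoints C (D⊆C f∈))
    ... | f , f∈ , inj₂ refl = proj₂ (reachEndpoints C (D⊆C f∈))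

    minimallyConnected⇔spanningTree : Minimally (Connected G) S ⇔ IsSpanningTree G S
    minimallyConnected⇔spanningTree = mk⇔ tree minimal
      where
      tree : Minimally (Connected G) S → IsSpanningTree G S
      tree (conn , minimal) = conn , λ C → case firstEdge C of λ { (e , e∈ , _) →
        minimal e (walkEdges⊆ (Cycle.walk C) e∈) λ a b → bypass (Detour.detour (cycleDetour C e∈)) (conn a b) }

      minimal : IsSpanningTree G S → Minimally (Connected G) S
      minimal (conn , acyclic) = conn , λ e s conn′ → acyclic (proj₁ (cycleThrough s (conn′ (src G e) (tgt G e))))

module Potentials (R : RealNumbers) {n m : ℕ} (G : GainGraph n m) where
  open RealNumbers R
  open OrderedFieldFacts R
  open WalkCalculus G

  -- The horizontal (σ = unsigned) and vertical (σ = reflects) coordinates of a symmetric motion are such potentials.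
  record IsPotential (σ : Fin m → Bool) (S : EdgeSet) (f : Fin n → ℝ) : Set where
    constructor potential
    field
      on-edge : ∀ {e} → S e → f (src G e) ≡ negateIf (σ e) (f (tgt G e))
  open IsPotential public

  unsigned : Fin m → Bool
  unsigned _ = false

  AllPotentialsConstant : EdgeSet → Set
  AllPotentialsConstant S = ∀ f → IsPotential unsigned S f → ∀ a b → f a ≡ f b

  AllPotentialsZero : (Fin m → Bool) → EdgeSet → Set
  AllPotentialsZero σ S = ∀ f → IsPotential σ S f → ∀ v → f v ≡ 0ℝ

  module _ {σ : Fin m → Bool} {S : EdgeSet} {f : Fin n → ℝ} (pot : IsPotential σ S f) where

    potential-along : ∀ {a b} (w : Walk G S a b) → f a ≡ negateIf (parity σ w) (f b)
    potential-along []          = refl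
    potential-along (fwd e s w) = begin
      f (src G e)                                       ≡⟨ on-edge pot s ⟩
      negateIf (σ e) (f (tgt G e))                      ≡⟨ cong (negateIf (σ e)) (potential-along w) ⟩
      negateIf (σ e) (negateIf (parity σ w) (f _))      ≡⟨ negateIf-xor (σ e) (parity σ w) _ ⟨
      negateIf (σ e xor parity σ w) (f _)               ∎
      where open ≡-Reasoning
    potential-along (bwd e s w) = begin
      f (tgt G e)                                       ≡⟨ negateIf-involutive (σ e) (f (tgt G e)) ⟨
      negateIf (σ e) (negateIf (σ e) (f (tgt G e)))     ≡⟨ cong (negateIf (σ e)) (on-edge pot s) ⟨
      negateIf (σ e) (f (src G e))                      ≡⟨ cong (negateIf (σ e)) (potential-along w) ⟩
      negateIf (σ e) (negateIf (parity σ w) (f _))      ≡⟨ negateIf-xor (σ e) (parity σ w) _ ⟨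
      negateIf (σ e xor parity σ w) (f _)               ∎
      where open ≡-Reasoning

    nonzero-along : ∀ {a b} → Walk G S a b → ¬ f a ≡ 0ℝ → ¬ f b ≡ 0ℝ
    nonzero-along w fa≢0 fb≡0 = fa≢0 (trans (potential-along w) (trans (cong (negateIf (parity σ w)) fb≡0) (negateIf-0 (parity σ w))))

    zero-on-odd-closed-walk : ∀ {a} (c : Walk G S a a) → parity σ c ≡ true → f a ≡ 0ℝ
    zero-on-odd-closed-walk c odd = x≡-x⇒x≡0 (trans (potential-along c) (cong (λ b → negateIf b _) odd))

  zero-potential : ∀ {σ S} → IsPotential σ S (λ _ → 0ℝ)
  zero-potential {σ} = potential λ {e} _ → sym (negateIf-0 (σ e))

  potential-antitone : ∀ {σ S T f} → S ⊆ T → IsPotential σ T f → IsPotential σ S f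
  potential-antitone S⊆T pot = potential (on-edge pot ∘ S⊆T)

  allPotentialsConstant-mono : ∀ {S T} → S ⊆ T → AllPotentialsConstant S → AllPotentialsConstant T
  allPotentialsConstant-mono S⊆T const f pot = const f (potential-antitone S⊆T pot)

  allPotentialsZero-mono : ∀ {σ S T} → S ⊆ T → AllPotentialsZero σ S → AllPotentialsZero σ T
  allPotentialsZero-mono S⊆T allZero f pot = allZero f (potential-antitone S⊆T pot)

  parity-unsigned : ∀ {S : EdgeSet} {a b} (w : Walk G S a b) → parity unsigned w ≡ false
  parity-unsigned []          = refl
  parity-unsigned (fwd e s w) = parity-unsigned w
  parity-unsigned (bwd e s w) = parity-unsigned w

  unsigned-balanced : ∀ {S : EdgeSet} {r} → Balanced {S} unsigned r
  unsigned-balanced w₁ w₂ = trans (parity-unsigned w₁) (sym (parity-unsigned w₂))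

  module _ {S : EdgeSet} (S? : Decidable S) where
    open Reachability S?

    balancedPotential : ∀ {σ r} → Balanced σ r →
      Σ (Fin n → ℝ) λ f → IsPotential σ S f × ¬ f r ≡ 0ℝ × (∀ v → ¬ Walk G S r v → f v ≡ 0ℝ)
    balancedPotential {σ} {r} bal = f , isPotential , fr≢0 , outside
      where
      f : Fin n → ℝ
      f v with walk? r v
      ... | yes w = negateIf (parity σ w) 1ℝ
      ... | no  _ = 0ℝ

      consistent : ∀ e → S e → f (src G e) ≡ negateIf (σ e) (f (tgt G e))
      consistent e s with walk? r (src G e) | walk? r (tgt G e)
      ... | yes P | yes Q = begin
        negateIf (parity σ P) 1ℝ                          ≡⟨ cong (λ b → negateIf b 1ℝ) (bal P (Q ++ʷ bwd e s [])) ⟩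
        negateIf (parity σ (Q ++ʷ bwd e s [])) 1ℝ         ≡⟨ cong (λ b → negateIf b 1ℝ) (parity-++ʷ σ Q (bwd e s [])) ⟩
        negateIf (parity σ Q xor (σ e xor false)) 1ℝ      ≡⟨ cong (λ b → negateIf (parity σ Q xor b) 1ℝ) (Bool.xor-identityʳ (σ e)) ⟩
        negateIf (parity σ Q xor σ e) 1ℝ                  ≡⟨ cong (λ b → negateIf b 1ℝ) (Bool.xor-comm (parity σ Q) (σ e)) ⟩
        negateIf (σ e xor parity σ Q) 1ℝ                  ≡⟨ negateIf-xor (σ e) (parity σ Q) 1ℝ ⟩
        negateIf (σ e) (negateIf (parity σ Q) 1ℝ)         ∎
        where open ≡-Reasoning
      ... | yes P | no ¬Q = ⊥-elim (¬Q (P ++ʷ fwd e s []))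
      ... | no ¬P | yes Q = ⊥-elim (¬P (Q ++ʷ bwd e s []))
      ... | no  _ | no  _ = sym (negateIf-0 (σ e))

      isPotential : IsPotential σ S f
      isPotential = potential λ {e} → consistent e

      fr≢0 : ¬ f r ≡ 0ℝ
      fr≢0 with walk? r r
      ... | yes c = λ eq → 0≢1 (sym (negateIf-≡0 (parity σ c) eq))
      ... | no ¬c = ⊥-elim (¬c [])

      outside : ∀ v → ¬ Walk G S r v → f v ≡ 0ℝ
      outside v ¬w with walk? r v
      ... | yes w = ⊥-elim (¬w w)
      ... | no  _ = refl

    connected⇔allPotentialsConstant : Connected G S ⇔ AllPotentialsConstant S
    connected⇔allPotentialsConstant = mk⇔ constant connected
      where
      constant : Connected G S → AllPotentialsConstant S
      constant conn f pot a b = trans (potential-along pot (conn a b)) (cong (λ z → negateIf z (f b)) (parity-unsigned (conn a b)))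

      connected : AllPotentialsConstant S → Connected G S
      connected const a b with walk? a b | balancedPotential (unsigned-balanced {r = a})
      ... | yes w | _                       = w
      ... | no ¬w | f , pot , fa≢0 , outside = ⊥-elim (fa≢0 (trans (const f pot a b) (outside b ¬w)))

    allPotentialsZero⇔unbalanced : ∀ σ → AllPotentialsZero σ S ⇔ (∀ r → UnbalancedAt σ r)
    allPotentialsZero⇔unbalanced σ = mk⇔ unbalanced allZero
      where
      unbalanced : AllPotentialsZero σ S → ∀ r → UnbalancedAt σ r
      unbalanced allZero r with balanced-or-unbalanced σ r
      ... | inj₂ unbal = unbal
      ... | inj₁ bal with balancedPotential bal
      ...   | f , pot , fr≢0 , _ = ⊥-elim (fr≢0 (allZero f pot r))

      allZero : (∀ r → UnbalancedAt σ r) → AllPotentialsZero σ S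
      allZero unbal f pot v = zero-on-odd-closed-walk pot (proj₁ (unbal v)) (proj₂ (unbal v))

module SymmetricMotions (R : RealNumbers) {n m : ℕ} (G : GainGraph n m) (p : Fin n → Geometry.ℝ² R) where
  open RealNumbers R
  open OrderedFieldFacts R
  open PlaneActionFacts R
  open Geometry R
  open WalkCalculus G
  open Potentials R G

  baseDirection : Fin m → ℝ²
  baseDirection e = p (src G e) -² act (gain G e) (p (tgt G e))

  κ-dirOf : ∀ e γ → κ (dirOf G p e γ) ≡ κ (baseDirection e)
  κ-dirOf e γ = begin
    κ (act γ (p (src G e)) -² act (γ ∙ gain G e) (p (tgt G e)))
      ≡⟨ cong (λ x → κ (act γ (p (src G e)) -² x)) (act-∙ γ (gain G e) (p (tgt G e))) ⟩
    κ (act γ (p (src G e)) -² act γ (act (gain G e) (p (tgt G e))))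
      ≡⟨ cong κ (act-difference γ _ _) ⟩
    κ (lin γ (baseDirection e))
      ≡⟨ κ-lin γ (baseDirection e) ⟩
    κ (baseDirection e) ∎
    where open ≡-Reasoning

  colour₁⇔ : ∀ {e} → Colour₁ G p e ⇔ κ (baseDirection e) ≡ (1ℝ , 0ℝ)
  colour₁⇔ {e} = mk⇔ (λ c → trans (sym (κ-dirOf e idΓ)) (c idΓ)) (λ k γ → trans (κ-dirOf e γ) k)

  colour₂⇔ : ∀ {e} → Colour₂ G p e ⇔ κ (baseDirection e) ≡ (0ℝ , 1ℝ)
  colour₂⇔ {e} = mk⇔ (λ c → trans (sym (κ-dirOf e idΓ)) (c idΓ)) (λ k γ → trans (κ-dirOf e γ) k)

  colours-disjoint : ∀ {e} → Colour₁ G p e → Colour₂ G p e → ⊥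
  colours-disjoint c₁ c₂ = 0≢1 (cong proj₁ (trans (sym (Equivalence.to colour₂⇔ c₂)) (Equivalence.to colour₁⇔ c₁)))

  module _ (wp : WellPositioned G p) where

    colour : ∀ e → Colour₁ G p e ⊎ Colour₂ G p e
    colour e with κ-values (baseDirection e)
    ... | inj₁ k        = inj₁ (Equivalence.from colour₁⇔ k)
    ... | inj₂ (inj₁ k) = inj₂ (Equivalence.from colour₂⇔ k)
    ... | inj₂ (inj₂ k) = ⊥-elim (wp e idΓ (trans (κ-dirOf e idΓ) k))

    colour₁? : Decidable (Colour₁ G p)
    colour₁? e with colour e
    ... | inj₁ c₁ = yes c₁
    ... | inj₂ c₂ = no λ c₁ → colours-disjoint c₁ c₂

    colour₂? : Decidable (Colour₂ G p)
    colour₂? e with colour e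
    ... | inj₁ c₁ = no λ c₂ → colours-disjoint c₁ c₂
    ... | inj₂ c₂ = yes c₂

  Motion : Set
  Motion = Γ × Fin n → ℝ²

  horizontal vertical : Motion → Fin n → ℝ
  horizontal u v = proj₁ (u (idΓ , v))
  vertical   u v = proj₂ (u (idΓ , v))

  EdgeConstraint : Motion → Fin m → Γ → Set
  EdgeConstraint u e γ = κ (dirOf G p e γ) · (u (γ , src G e) -² u (γ ∙ gain G e , tgt G e)) ≡ 0ℝ

  symmetric⇒lin : ∀ {u} → IsΓSymmetric G p u → ∀ γ v → u (γ , v) ≡ lin γ (u (idΓ , v))
  symmetric⇒lin {u} u-sym γ v = trans (cong (λ δ → u (δ , v)) (sym (∙-identityʳ γ))) (u-sym γ idΓ v)

  relativeMotion : Motion → Fin m → ℝ²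
  relativeMotion u e = (horizontal u (src G e) + - horizontal u (tgt G e) ,
                        vertical u (src G e) + - negateIf (reflects e) (vertical u (tgt G e)))

  constraint≡ : ∀ {u} → IsΓSymmetric G p u → ∀ e γ →
    κ (dirOf G p e γ) · (u (γ , src G e) -² u (γ ∙ gain G e , tgt G e)) ≡ κ (baseDirection e) · lin γ (relativeMotion u e)
  constraint≡ {u} u-sym e γ = cong₂ _·_ (κ-dirOf e γ) (begin
    u (γ , s) -² u (γ ∙ g , t)                   ≡⟨ cong₂ _-²_ (symmetric⇒lin u-sym γ s) (symmetric⇒lin u-sym (γ ∙ g) t) ⟩
    lin γ (U s) -² lin (γ ∙ g) (U t)              ≡⟨ cong (lin γ (U s) -²_) (lin-∙ γ g (U t)) ⟩
    lin γ (U s) -² lin γ (lin g (U t))            ≡⟨ lin-difference γ (U s) (lin g (U t)) ⟨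
    lin γ (U s -² lin g (U t))                    ≡⟨ cong (λ v → lin γ (U s -² v)) (lin≡negateIf g (U t)) ⟩
    lin γ (relativeMotion u e)                    ∎)
    where
    open ≡-Reasoning
    s = src G e
    t = tgt G e
    g = gain G e
    U = λ v → u (idΓ , v)

  [1,0]·lin : ∀ γ a b → (1ℝ , 0ℝ) · lin γ (a , b) ≡ a
  [1,0]·lin γ a b = begin
    (1ℝ , 0ℝ) · lin γ (a , b)                        ≡⟨ cong ((1ℝ , 0ℝ) ·_) (lin≡negateIf γ (a , b)) ⟩
    1ℝ * a + 0ℝ * negateIf (refl? γ) b               ≡⟨ cong₂ _+_ (*-identityˡ a) (zeroˡ _) ⟩
    a + 0ℝ                                           ≡⟨ +-identityʳ a ⟩
    a                                                ∎
    where open ≡-Reasoning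

  [0,1]·lin : ∀ γ a b → (0ℝ , 1ℝ) · lin γ (a , b) ≡ negateIf (refl? γ) b
  [0,1]·lin γ a b = begin
    (0ℝ , 1ℝ) · lin γ (a , b)                        ≡⟨ cong ((0ℝ , 1ℝ) ·_) (lin≡negateIf γ (a , b)) ⟩
    0ℝ * a + 1ℝ * negateIf (refl? γ) b               ≡⟨ cong₂ _+_ (zeroˡ a) (*-identityˡ _) ⟩
    0ℝ + negateIf (refl? γ) b                        ≡⟨ +-identityˡ _ ⟩
    negateIf (refl? γ) b                             ∎
    where open ≡-Reasoning

  module _ {u : Motion} (u-sym : IsΓSymmetric G p u) {e : Fin m} where

    colour₁-constraint : Colour₁ G p e →
      (∀ γ → EdgeConstraint u e γ) ⇔ horizontal u (src G e) ≡ horizontal u (tgt G e)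
    colour₁-constraint c₁ = mk⇔ (λ con → x-y≡0⇒x≡y _ _ (trans (sym (value idΓ)) (con idΓ)))
                                (λ eq γ → trans (value γ) (x≡y⇒x-y≡0 eq))
      where
      value : ∀ γ → κ (dirOf G p e γ) · (u (γ , src G e) -² u (γ ∙ gain G e , tgt G e)) ≡
                    horizontal u (src G e) + - horizontal u (tgt G e)
      value γ = trans (constraint≡ u-sym e γ)
        (trans (cong (_· lin γ (relativeMotion u e)) (Equivalence.to colour₁⇔ c₁)) ([1,0]·lin γ _ _))

    colour₂-constraint : Colour₂ G p e →
      (∀ γ → EdgeConstraint u e γ) ⇔ vertical u (src G e) ≡ negateIf (reflects e) (vertical u (tgt G e))
    colour₂-constraint c₂ = mk⇔ (λ con → x-y≡0⇒x≡y _ _ (trans (sym (value idΓ)) (con idΓ)))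
                                (λ eq γ → trans (value γ) (trans (cong (negateIf (refl? γ)) (x≡y⇒x-y≡0 eq)) (negateIf-0 (refl? γ))))
      where
      value : ∀ γ → κ (dirOf G p e γ) · (u (γ , src G e) -² u (γ ∙ gain G e , tgt G e)) ≡
                    negateIf (refl? γ) (vertical u (src G e) + - negateIf (reflects e) (vertical u (tgt G e)))
      value γ = trans (constraint≡ u-sym e γ)
        (trans (cong (_· lin γ (relativeMotion u e)) (Equivalence.to colour₂⇔ c₂)) ([0,1]·lin γ _ _))

  module _ (wp : WellPositioned G p) {T : EdgeSet} {u : Motion} (u-sym : IsΓSymmetric G p u) where

    infMotion⇔potentials : IsInfMotion G p T u ⇔
      (IsPotential unsigned (T ∩ Colour₁ G p) (horizontal u) × IsPotential reflects (T ∩ Colour₂ G p) (vertical u))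
    infMotion⇔potentials = mk⇔ toPotentials fromPotentials
      where
      toPotentials : IsInfMotion G p T u → _
      toPotentials mot =
        potential (λ { {e} (t , c₁) → Equivalence.to (colour₁-constraint u-sym c₁) (mot e t) }) ,
        potential (λ { {e} (t , c₂) → Equivalence.to (colour₂-constraint u-sym c₂) (mot e t) })

      fromPotentials : _ → IsInfMotion G p T u
      fromPotentials (pot₁ , pot₂) e t with colour wp e
      ... | inj₁ c₁ = Equivalence.from (colour₁-constraint u-sym c₁) (on-edge pot₁ (t , c₁))
      ... | inj₂ c₂ = Equivalence.from (colour₂-constraint u-sym c₂) (on-edge pot₂ (t , c₂))

  trivial⇔ : ∀ {u} → IsΓSymmetric G p u →
    IsTrivial G p u ⇔ ((∀ a b → horizontal u a ≡ horizontal u b) × (∀ v → vertical u v ≡ 0ℝ))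
  trivial⇔ {u} u-sym = mk⇔
    (λ triv → (λ a b → cong proj₁ (triv (idΓ , a) (idΓ , b))) ,
              (λ v → x≡-x⇒x≡0 (cong proj₂ (trans (triv (idΓ , v) (reflection , v)) (symmetric⇒lin u-sym reflection v)))))
    (λ { (const , allZero) (γ , a) (δ , b) → trans (onOrbit const allZero γ a)
                                            (trans (cong (_, 0ℝ) (const a b)) (sym (onOrbit const allZero δ b))) })
    where
    reflection : Γ
    reflection = ⟨ ℤ.+ 0 , ℤ.+ 0 , true ⟩
    onOrbit : (∀ a b → horizontal u a ≡ horizontal u b) → (∀ v → vertical u v ≡ 0ℝ) →
              ∀ γ a → u (γ , a) ≡ (horizontal u a , 0ℝ)
    onOrbit const allZero γ a = trans (symmetric⇒lin u-sym γ a)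
      (trans (lin≡negateIf γ _) (cong (horizontal u a ,_) (trans (cong (negateIf (refl? γ)) (allZero a)) (negateIf-0 (refl? γ)))))

  fromComponents : (Fin n → ℝ) → (Fin n → ℝ) → Motion
  fromComponents f g (γ , v) = lin γ (f v , g v)

  fromComponents-symmetric : ∀ f g → IsΓSymmetric G p (fromComponents f g)
  fromComponents-symmetric f g γ δ v = lin-∙ γ δ (f v , g v)

  symInfRigid⇔ : WellPositioned G p → ∀ T →
    SymInfRigid G p T ⇔ (AllPotentialsConstant (T ∩ Colour₁ G p) × AllPotentialsZero reflects (T ∩ Colour₂ G p))
  symInfRigid⇔ wp T = mk⇔ split join
    where
    rigid⇒trivial : SymInfRigid G p T → ∀ f g → IsPotential unsigned (T ∩ Colour₁ G p) f →
                    IsPotential reflects (T ∩ Colour₂ G p) g →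
                    (∀ a b → f a ≡ f b) × (∀ v → g v ≡ 0ℝ)
    rigid⇒trivial rigid f g pot₁ pot₂ = Equivalence.to (trivial⇔ u-sym)
      (rigid u u-sym (Equivalence.from (infMotion⇔potentials wp u-sym) (pot₁ , pot₂)))
      where
      u = fromComponents f g
      u-sym = fromComponents-symmetric f g

    split : SymInfRigid G p T → _
    split rigid = (λ f pot → proj₁ (rigid⇒trivial rigid f (λ _ → 0ℝ) pot zero-potential)) ,
                  (λ g pot → proj₂ (rigid⇒trivial rigid (λ _ → 0ℝ) g zero-potential pot))

    join : _ → SymInfRigid G p T
    join (constant , allZero) u u-sym mot with Equivalence.to (infMotion⇔potentials wp u-sym) mot
    ... | pot₁ , pot₂ = Equivalence.from (trivial⇔ u-sym) (constant _ pot₁ , allZero _ pot₂)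

  minSymInfRigid⇔ : WellPositioned G p →
    MinSymInfRigid G p ⇔ (Minimally AllPotentialsConstant (Colour₁ G p) × Minimally (AllPotentialsZero reflects) (Colour₂ G p))
  minSymInfRigid⇔ wp = mk⇔ split join
    where
    rigid⇔ = symInfRigid⇔ wp
    open Equivalence using (to; from)

    split : MinSymInfRigid G p → _
    split (rigid , minimal) =
      (allPotentialsConstant-mono proj₂ (proj₁ (to (rigid⇔ _) rigid)) , minimal₁) ,
      (allPotentialsZero-mono proj₂ (proj₂ (to (rigid⇔ _) rigid)) , minimal₂)
      where
      minimal₁ : ∀ e → Colour₁ G p e → ¬ AllPotentialsConstant (Colour₁ G p ∖ ｛ e ｝)
      minimal₁ e c₁ const = minimal e (from (rigid⇔ _)
        ( allPotentialsConstant-mono (λ { (c , e≢f) → (λ f≡e → e≢f (sym f≡e)) , c }) const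
        , allPotentialsZero-mono (λ { (_ , c₂) → (λ { refl → colours-disjoint c₁ c₂ }) , c₂ }) (proj₂ (to (rigid⇔ _) rigid))))
      minimal₂ : ∀ e → Colour₂ G p e → ¬ AllPotentialsZero reflects (Colour₂ G p ∖ ｛ e ｝)
      minimal₂ e c₂ allZero = minimal e (from (rigid⇔ _)
        ( allPotentialsConstant-mono (λ { (_ , c₁) → (λ { refl → colours-disjoint c₁ c₂ }) , c₁ }) (proj₁ (to (rigid⇔ _) rigid))
        , allPotentialsZero-mono (λ { (c , e≢f) → (λ f≡e → e≢f (sym f≡e)) , c }) allZero))

    join : _ → MinSymInfRigid G p
    join ((const , minimal₁) , (allZero , minimal₂)) =
      from (rigid⇔ _) (allPotentialsConstant-mono (tt ,_) const , allPotentialsZero-mono (tt ,_) allZero) ,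
      λ e rigid′ → let const′ , allZero′ = to (rigid⇔ _) rigid′ in case colour wp e of λ
        { (inj₁ c₁) → minimal₁ e c₁ (allPotentialsConstant-mono (λ { (f≢e , c) → c , λ e≡f → f≢e (sym e≡f) }) const′)
        ; (inj₂ c₂) → minimal₂ e c₂ (allPotentialsZero-mono (λ { (f≢e , c) → c , λ e≡f → f≢e (sym e≡f) }) allZero′) }

module PotentialRigidity (R : RealNumbers) {n m : ℕ} (G : GainGraph n m) where
  open RealNumbers R
  open OrderedFieldFacts R
  open WalkCalculus G
  open Potentials R G
  open import Data.List.Membership.DecPropositional (Fin._≟_ {m}) using () renaming (_∈?_ to _∈ᵉ?_)

  minimallyConstant⇔spanningTree : ∀ {S} → Decidable S → Minimally AllPotentialsConstant S ⇔ IsSpanningTree G S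
  minimallyConstant⇔spanningTree S? =
    ⇔.trans (Minimally-⇔ (λ T? → ⇔.sym (connected⇔allPotentialsConstant T?)) S?) minimallyConnected⇔spanningTree

  allPotentialsZero⇔notPurelyPeriodic : ∀ {S} → Decidable S → AllPotentialsZero reflects S ⇔ (∀ v → ¬ ComponentPurelyPeriodic G S v)
  allPotentialsZero⇔notPurelyPeriodic S? = ⇔.trans (allPotentialsZero⇔unbalanced S? reflects)
    (mk⇔ (λ unbal v → Equivalence.to (unbalanced⇔notPurelyPeriodic S? v) (unbal v))
         (λ notPP v → Equivalence.from (unbalanced⇔notPurelyPeriodic S? v) (notPP v)))

  module _ {σ : Fin m → Bool} {S : EdgeSet} where

    redundant : ∀ {e} →
      (∀ f → IsPotential σ (S ∖ ｛ e ｝) f → f (src G e) ≡ negateIf (σ e) (f (tgt G e))) →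
      AllPotentialsZero σ S → AllPotentialsZero σ (S ∖ ｛ e ｝)
    redundant {e} forced allZero f pot = allZero f (potential restored)
      where
      restored : ∀ {e′} → S e′ → f (src G e′) ≡ negateIf (σ e′) (f (tgt G e′))
      restored {e′} s′ with e Fin.≟ e′
      ... | yes refl = forced f pot
      ... | no  e≢e′ = on-edge pot (s′ , e≢e′)

    along-detour : ∀ {f e} → IsPotential σ (S ∖ ｛ e ｝) f → (C : Cycle G S) (e∈ : e ∈ walkEdges G (Cycle.walk C)) →
      f (src G e) ≡ negateIf (σ e xor parity σ (Cycle.walk C)) (f (tgt G e))
    along-detour {f} {e} pot C e∈ = begin
      f (src G e)                                     ≡⟨ negateIf-involutive (parity σ d) _ ⟨
      negateIf (parity σ d) (negateIf (parity σ d) (f (src G e)))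
                                                      ≡⟨ cong (negateIf (parity σ d)) (potential-along pot d) ⟨
      negateIf (parity σ d) (f (tgt G e))
        ≡⟨ cong (λ b → negateIf b (f (tgt G e))) (Detour.detour-parity (cycleDetour C e∈) σ) ⟩
      negateIf (σ e xor parity σ (Cycle.walk C)) (f (tgt G e)) ∎
      where
      open ≡-Reasoning
      d = Detour.detour (cycleDetour C e∈)

  module _ {S : EdgeSet} (minimal : Minimally (AllPotentialsZero reflects) S) where

    cycle-unbalanced : (C : Cycle G S) → parity reflects (Cycle.walk C) ≡ true
    cycle-unbalanced C with parity reflects (Cycle.walk C) in balanced
    ... | true  = refl
    ... | false with firstEdge C
    ...   | e , e∈ , _ = ⊥-elim (proj₂ minimal e (walkEdges⊆ (Cycle.walk C) e∈) (redundant forced (proj₁ minimal)))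
      where
      forced : ∀ f → IsPotential reflects (S ∖ ｛ e ｝) f → f (src G e) ≡ negateIf (reflects e) (f (tgt G e))
      forced f pot = trans (along-detour pot C e∈)
        (cong (λ b → negateIf b (f (tgt G e))) (trans (cong (reflects e xor_) balanced) (Bool.xor-identityʳ (reflects e))))

    -- a potential of S ∖ {e} that vanishes at tgt e satisfies e's equation by the detour around C;
    -- otherwise it is nonzero along the way to the unbalanced cycle D, which avoids e
    cycles-share-edges : (C D : Cycle G S) → Walk G S (Cycle.base C) (Cycle.base D) →
                         ∀ {e} → e ∈ walkEdges G (Cycle.walk C) → e ∈ walkEdges G (Cycle.walk D)
    cycles-share-edges C D C⇝D {e} e∈C with e ∈ᵉ? walkEdges G (Cycle.walk D)
    ... | yes e∈D = e∈D
    ... | no  e∉D = ⊥-elim (proj₂ minimal e (walkEdges⊆ (Cycle.walk C) e∈C) (redundant forced (proj₁ minimal)))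
      where
      forced : ∀ f → IsPotential reflects (S ∖ ｛ e ｝) f → f (src G e) ≡ negateIf (reflects e) (f (tgt G e))
      forced f pot with f (tgt G e) ≟ 0ℝ
      ... | yes ftgt≡0 = trans (along-detour pot C e∈C) (trans (vanishes (reflects e xor _)) (sym (vanishes (reflects e))))
        where
        vanishes : ∀ a → negateIf a (f (tgt G e)) ≡ 0ℝ
        vanishes a = trans (cong (negateIf a) ftgt≡0) (negateIf-0 a)
      ... | no  ftgt≢0 = ⊥-elim (nonzero-along pot toD ftgt≢0 (zero-on-odd-closed-walk pot D′ D′-odd))
        where
        toD = bypass (Detour.detour (cycleDetour C e∈C)) (reverse (proj₂ (reachEndpoints C e∈C)) ++ʷ C⇝D)
        D′ = avoiding (Cycle.walk D) e∉D
        D′-odd = trans (parity-avoiding reflects (Cycle.walk D) e∉D) (cycle-unbalanced D)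

    spanningMapGraph : Decidable S → IsSpanningMapGraph G S
    spanningMapGraph S? v with Equivalence.to (allPotentialsZero⇔unbalanced S? reflects) (proj₁ minimal) v
    ... | c , odd = C , v⇝C , λ D v⇝D e → mk⇔ (cycles-share-edges C D (reverse v⇝C ++ʷ v⇝D))
                                              (cycles-share-edges D C (reverse v⇝D ++ʷ v⇝C))
      where open OddCycleFrom (oddCycle reflects c odd) renaming (cycle to C; reach to v⇝C)

  -- two unbalanced cycles of S ∖ {e}, one on each side of e, would close up through e
  -- into a cycle containing e in the component of src e, whose only cycle avoids e
  mapGraph⇒minimal : ∀ {S} → Decidable S → IsSpanningMapGraph G S →
                     ∀ e → S e → ¬ AllPotentialsZero reflects (S ∖ ｛ e ｝)
  mapGraph⇒minimal {S} S? mapGraph e s allZero′ = e∉D₁ (to (sameD₁ e) (from (sameE e) e∈E))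
    where
    open Equivalence using (to; from)
    unbalanced = Equivalence.to (allPotentialsZero⇔unbalanced (without? S? e) reflects) allZero′
    D₁-from = oddCycle reflects (proj₁ (unbalanced (src G e))) (proj₂ (unbalanced (src G e)))
    D₂-from = oddCycle reflects (proj₁ (unbalanced (tgt G e))) (proj₂ (unbalanced (tgt G e)))
    open OddCycleFrom D₁-from renaming (cycle to D₁; reach to src⇝D₁)
    open OddCycleFrom D₂-from renaming (cycle to D₂; reach to tgt⇝D₂)
    C = proj₁ (mapGraph (src G e))
    unique = proj₂ (proj₂ (mapGraph (src G e)))
    sameD₁ = unique (mapᶜ proj₁ D₁) (mapʷ proj₁ src⇝D₁)
    sameD₂ = unique (mapᶜ proj₁ D₂) (fwd e s (mapʷ proj₁ tgt⇝D₂))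

    edges-mapᶜ : (D : Cycle G (S ∖ ｛ e ｝)) → walkEdges G (Cycle.walk (mapᶜ proj₁ D)) ≡ walkEdges G (Cycle.walk D)
    edges-mapᶜ D = walkEdges-restrict (Cycle.walk D) _

    e∉D₁ : e ∉ walkEdges G (Cycle.walk (mapᶜ proj₁ D₁))
    e∉D₁ e∈ = proj₂ (walkEdges⊆ (Cycle.walk D₁) (subst (e ∈_) (edges-mapᶜ D₁) e∈)) refl

    D₂⊆D₁ : ∀ {f} → f ∈ walkEdges G (Cycle.walk D₂) → f ∈ walkEdges G (Cycle.walk D₁)
    D₂⊆D₁ {f} f∈ = subst (f ∈_) (edges-mapᶜ D₁)
      (to (sameD₁ f) (from (sameD₂ f) (subst (f ∈_) (sym (edges-mapᶜ D₂)) f∈)))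

    E-through = cycleThrough s (src⇝D₁ ++ʷ reachBaseThrough D₁ D₂ D₂⊆D₁ ++ʷ reverse tgt⇝D₂)
    sameE = unique (proj₁ E-through) (proj₁ (proj₂ E-through))
    e∈E = proj₂ (proj₂ E-through)

  minimallyZero⇔mapGraph : ∀ {S} → Decidable S →
    Minimally (AllPotentialsZero reflects) S ⇔ (IsSpanningMapGraph G S × (∀ v → ¬ ComponentPurelyPeriodic G S v))
  minimallyZero⇔mapGraph S? = mk⇔
    (λ minimal → spanningMapGraph minimal S? , Equivalence.to (allPotentialsZero⇔notPurelyPeriodic S?) (proj₁ minimal))
    (λ (mapGraph , notPP) → Equivalence.from (allPotentialsZero⇔notPurelyPeriodic S?) notPP , mapGraph⇒minimal S? mapGraph)

proposition10p2 : (R : RealNumbers) → (n m : ℕ) → (G : GainGraph n m) →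
  (p : Fin n → Geometry.ℝ² R) →
  Geometry.Derives R G p → Geometry.WellPositioned R G p →
  Geometry.MinSymInfRigid R G p ⇔
    (IsSpanningTree G (Geometry.Colour₁ R G p) ×
     (IsSpanningMapGraph G (Geometry.Colour₂ R G p) ×
      (∀ v → ¬ ComponentPurelyPeriodic G (Geometry.Colour₂ R G p) v)))
proposition10p2 R n m G p _ wp =
  ⇔.trans (minSymInfRigid⇔ wp) (minimallyConstant⇔spanningTree (colour₁? wp) ×-⇔ minimallyZero⇔mapGraph (colour₂? wp))
  where
  open SymmetricMotions R G p
  open PotentialRigidity R G
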